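{- Let $\mathcal C\subseteq 2^{[n]}$ be a code and suppose $n$ is a $k$-piercing of $\mathcal C$ with associated interval $[\sigma,\tau]$. Then $$\mathrm{CF}(J_{\mathcal C})=\mathrm{CF}(J_{\mathcal C\setminus n})\sqcup\{x_nx_i : i\in[n-1]\setminus\tau\}\sqcup\{x_n(1-x_j): j\in\sigma\}.$$
   Context: $[n]=\{1,\dots,n\}$. A code is a set $\mathcal C\subseteq 2^{[n]}$ satisfying the standing conventions: $\emptyset\in\mathcal C$; every neuron lies in some codeword; no two distinct neurons lie in exactly the same codewords. $\mathcal C\setminus n$ is the code on $[n-1]$ obtained by removing $n$ from every codeword. $[\sigma,\tau]=\{\gamma:\sigma\subseteq\gamma\subseteq\tau\}$, of rank $|\tau\setminus\sigma|$. The neuron $n$ is a $k$-piercing of $\mathcal C$ with associated interval $[\sigma,\tau]$ if $\sigma\subseteq\tau\subseteq[n-1]$, $[\sigma,\tau]$ has rank $k$, $[\sigma,\tau]\subseteq\mathcal C\setminus n$, and $\mathcal C=(\mathcal C\setminus n)\cup[\sigma\cup\{n\},\tau\cup\{n\}]$. Pseudo-monomials are $\prod_{i\in\alpha}x_i\prod_{j\in\beta}(1-x_j)$ with $\alpha\cap\beta=\emptyset$, ordered by divisibility. For a code $\mathcal D\subseteq 2^{[m]}$, $J_{\mathcal D}=\langle\prod_{i\in\alpha}x_i\prod_{j\in[m]\setminus\alpha}(1-x_j):\alpha\notin\mathcal D\rangle\subseteq\mathbb F_2[x_1,\dots,x_m]$ and $\mathrm{CF}(J_{\mathcal D})$ is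 its set of minimal pseudo-monomials. -}

module Defs where

open import Data.Bool using (Bool; true; false; not; _∨_; if_then_else_)
open import Data.Nat using (ℕ; zero; suc; _+_)
import Data.Nat.Properties as ℕP
open import Data.Fin using (Fin; fromℕ; inject₁)
import Data.Fin.Properties as FinP
open import Data.Fin.Subset using (Subset; _∈_; _∉_; _⊆_; _∩_; _─_; ∣_∣; ∁; ⊥; inside; outside)
open import Data.Vec using (Vec; _∷ʳ_; replicate; zipWith; tabulate; lookup)
import Data.Vec.Properties as VecP
open import Data.List using (List; []; _∷_; _++_; map; concatMap; concat; foldr; allFin)
open import Data.List.Relation.Unary.All using (All)
open import Data.Product using (Σ; ∃; ∃-syntax; _×_; _,_; proj₁; proj₂)
open import Data.Sum using (_⊎_)
open import Relation.Binary.PropositionalEquality using (_≡_)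
open import Relation.Nullary using (¬_)
open import Relation.Nullary.Decidable using (⌊_⌋)
open import Function.Bundles using (_⇔_)

-- Codes.  A subset of [n] is a 'Subset n' (Vec Bool n, position i = neuron i+1).
-- A code on [n] is given by its characteristic function on 2^[n].

Code : ℕ → Set
Code n = Subset n → Bool

_∈ᶜ_ : ∀ {n} → Subset n → Code n → Set
c ∈ᶜ C = C c ≡ true

IsCode : ∀ {n} → Code n → Set
IsCode {n} C =
  (⊥ ∈ᶜ C)
  × (∀ (i : Fin n) → ∃[ c ] (c ∈ᶜ C × i ∈ c))
  × (∀ (i j : Fin n) → (∀ c → c ∈ᶜ C → (i ∈ c ⇔ j ∈ c)) → i ≡ j)

-- For a code on [m+1] (neuron n = m+1 is the last coordinate, 'fromℕ m'),
-- C ∖ n : code on [m] obtained by deleting neuron n from every codeword.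
delete : ∀ {m} → Code (suc m) → Code m
delete C c = C (c ∷ʳ outside) ∨ C (c ∷ʳ inside)

_∈[_,_] : ∀ {n} → Subset n → Subset n → Subset n → Set
c ∈[ σ , τ ] = σ ⊆ c × c ⊆ τ

IsPiercing : ∀ {m} → ℕ → Code (suc m) → Subset m → Subset m → Set
IsPiercing {m} k C σ τ =
  σ ⊆ τ
  × ∣ τ ─ σ ∣ ≡ k
  × (∀ (c : Subset m) → c ∈[ σ , τ ] → c ∈ᶜ delete C)
  × (∀ (c : Subset (suc m)) →
       c ∈ᶜ C ⇔ ((∃[ c' ] (c ≡ c' ∷ʳ outside × c' ∈ᶜ delete C))
                 ⊎ c ∈[ σ ∷ʳ inside , τ ∷ʳ inside ]))

-- Polynomials in F₂[x₁,…,x_m]: a polynomial is represented by a finite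
-- list of monomials (exponent vectors), meaning their sum over F₂.
-- Two representations are equal iff every monomial has the same
-- coefficient (parity of its number of occurrences).

Mono : ℕ → Set
Mono m = Vec ℕ m

Poly : ℕ → Set
Poly m = List (Mono m)

coeff : ∀ {m} → Poly m → Mono m → Bool
coeff p e = foldr (λ e' b → if ⌊ VecP.≡-dec ℕP._≟_ e' e ⌋ then not b else b) false p

_≈ₚ_ : ∀ {m} → Poly m → Poly m → Set
p ≈ₚ q = ∀ e → coeff p e ≡ coeff q e

infixl 6 _+ₚ_
infixl 7 _*ₚ_
infix 4 _≈ₚ_ _∣ₚ_

_+ₚ_ : ∀ {m} → Poly m → Poly m → Poly m
p +ₚ q = p ++ q

_*ₚ_ : ∀ {m} → Poly m → Poly m → Poly m
p *ₚ q = concatMap (λ a → map (zipWith _+_ a) q) p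

oneₚ : ∀ {m} → Poly m
oneₚ {m} = replicate m 0 ∷ []

var : ∀ {m} → Fin m → Poly m
var i = tabulate (λ j → if ⌊ i FinP.≟ j ⌋ then 1 else 0) ∷ []

_∣ₚ_ : ∀ {m} → Poly m → Poly m → Set
f ∣ₚ g = ∃[ h ] (g ≈ₚ h *ₚ f)

-- the pseudo-monomial  ∏_{i∈α} x_i ∏_{j∈β} (1 - x_j)   (1 - x = 1 + x over F₂)
pm : ∀ {m} → Subset m → Subset m → Poly m
pm {m} α β = foldr (λ i acc → factor i *ₚ acc) oneₚ (allFin m)
  where
  factor : Fin m → Poly m
  factor i = (if lookup α i then var i else oneₚ)
             *ₚ (if lookup β i then oneₚ +ₚ var i else oneₚ)

IsPseudoMonomial : ∀ {m} → Poly m → Set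
IsPseudoMonomial f = ∃[ α ] ∃[ β ] (α ∩ β ≡ ⊥ × f ≈ₚ pm α β)

JGen : ∀ {m} → Code m → Poly m → Set
JGen D g = ∃[ α ] (D α ≡ false × g ≡ pm α (∁ α))

InJ : ∀ {m} → Code m → Poly m → Set
InJ {m} D f =
  ∃[ ps ] (All (λ (hg : Poly m × Poly m) → JGen D (proj₂ hg)) ps
           × f ≈ₚ concat (map (λ hg → proj₁ hg *ₚ proj₂ hg) ps))

InCF : ∀ {m} → Code m → Poly m → Set
InCF D f =
  IsPseudoMonomial f × InJ D f
  × (∀ g → IsPseudoMonomial g → InJ D g → g ∣ₚ f → g ≈ₚ f)

embedP : ∀ {m} → Poly m → Poly (suc m)
embedP p = map (_∷ʳ 0) p

Part₁ : ∀ {m} → Code (suc m) → Poly (suc m) → Set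
Part₁ C f = ∃[ g ] (InCF (delete C) g × f ≈ₚ embedP g)

Part₂ : ∀ {m} → Subset m → Poly (suc m) → Set
Part₂ {m} τ f = ∃[ i ] (i ∉ τ × f ≈ₚ var (fromℕ m) *ₚ var (inject₁ i))

Part₃ : ∀ {m} → Subset m → Poly (suc m) → Set
Part₃ {m} σ f = ∃[ j ] (j ∈ σ × f ≈ₚ var (fromℕ m) *ₚ (oneₚ +ₚ var (inject₁ j)))

{-# OPTIONS --safe #-}
-- Over F₂ a pseudo-monomial pm α β (α ∩ β = ∅) is multilinear and is the indicator function of its
-- box {x : α ⊆ x, β ∩ x = ∅}, and a multilinear polynomial is determined by its values on {0,1}^m.
-- Hence pm α β lies in J_D iff its box avoids D (it is then the sum of the generators of the points
-- of the box), and pm α′ β′ divides pm α β iff α′ ⊆ α and β′ ⊆ β: CF(J_D) consists of the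
-- pseudo-monomials of the minimal pairs (α, β) whose box avoids D.
-- When n pierces C, the codewords of C without n are those of C ∖ n, and those with n are the
-- c ∪ {n} with c ∈ [σ, τ]. So a minimal pair not involving n is a minimal pair for C ∖ n, no
-- minimal pair contains the literal 1 - x_n, and a pair containing x_n only has to avoid [σ, τ],
-- which one further literal x_i (i ∉ τ) or 1 - x_j (j ∈ σ) achieves; that these pairs are minimal
-- uses ∅ ∈ C and that i fires in some codeword.
module Submission where

open import Defs
open import Data.Nat using (ℕ; suc)
open import Data.Fin.Subset using (Subset)
open import Data.Product using (_×_)
open import Data.Sum using (_⊎_)
open import Relation.Nullary using (¬_)
open import Function.Bundles using (_⇔_)

open import Algebra.Bundles using (CommutativeMonoid)
open import Data.Bool using (Bool; true; false; not; _∧_; _∨_; _xor_; if_then_else_; T?)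
import Data.Bool.Properties as 𝔹
open import Data.Empty using (⊥-elim) renaming (⊥ to Empty)
open import Data.Fin using (Fin; fromℕ; inject₁) renaming (zero to fzero; suc to fsuc)
import Data.Fin.Properties as Fin
open import Data.Fin.Subset using (_∈_; _∉_; _⊆_; _∪_; _∩_; _─_; ⊥; ⁅_⁆; ∁; inside; outside)
open import Data.Fin.Subset.Properties
  using ( _∈?_; ∉⊥; ⊥⊆; ⊆-refl; ⊆-antisym; drop-∷-⊆; Empty-unique; nonempty?; x∈⁅x⁆; x∈⁅y⁆⇒x≡y
        ; p⊆p∪q; q⊆p∪q; x∈p∪q⁺; x∈p∪q⁻; x∈p∩q⁺; x∈p∩q⁻; p─q⊆p; x∈p∧x∉q⇒x∈p─q; x∉p⇒x∈∁p; x∈p⇒x∉∁p)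
open import Data.List using (List; []; _∷_; _++_; map; foldr; length; concat; filter)
import Data.List as List
open import Data.List.Membership.Propositional using () renaming (_∈_ to _∈ₗ_)
open import Data.List.Membership.Propositional.Properties using (∈-∃++)
open import Data.List.Properties using (length-++-sucʳ)
import Data.List.Properties as Listₚ
open import Data.List.Relation.Unary.All using (All; []; _∷_)
import Data.List.Relation.Unary.All as All
import Data.List.Relation.Unary.All.Properties as Allₚ
open import Data.List.Relation.Unary.Any using (here; there)
open import Data.Nat using (zero; _+_; _≤_; z≤n; s≤s)
import Data.Nat.Properties as ℕ
open import Data.Product using (∃-syntax; _,_; proj₁; proj₂; uncurry)
import Data.Product as Product
open import Data.Sum using (inj₁; inj₂; [_,_]′)
import Data.Sum as Sum
open import Data.Vec using (Vec; []; _∷_; here; there; initLast; _∷ʳ_; zipWith; tabulate; lookup)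
import Data.Vec.Properties as Vec
open import Function using (_∘_; id)
open import Function.Bundles using (Equivalence; mk⇔)
open import Relation.Binary.PropositionalEquality
open import Relation.Nullary using (Dec; yes; no; does; _because_)
open import Relation.Nullary.Decidable using (⌊_⌋; ⌊⌋-map′)
import Relation.Nullary.Decidable as Dec
open import Relation.Unary using (Decidable)

open import Algebra.Properties.CommutativeSemigroup
  (CommutativeMonoid.commutativeSemigroup 𝔹.∧-commutativeMonoid)
  using () renaming (interchange to ∧-interchange)

private variable
  A B : Set
  m : ℕ

xor-swap : ∀ a b c → a xor (b xor c) ≡ b xor (a xor c)
xor-swap true  true  c = refl
xor-swap true  false c = refl
xor-swap false b     c = refl

xor≡false⇒≡ : ∀ {a b} → a xor b ≡ false → a ≡ b
xor≡false⇒≡ {true}  {true}  _ = refl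
xor≡false⇒≡ {false} {false} _ = refl

∧-true⁻ : ∀ {a b} → a ∧ b ≡ true → a ≡ true × b ≡ true
∧-true⁻ {true} b≡true = refl , b≡true

∧-true⁺ : ∀ {a b} → a ≡ true → b ≡ true → a ∧ b ≡ true
∧-true⁺ refl b≡true = b≡true

≡true-ext : ∀ {a b} → (a ≡ true → b ≡ true) → (b ≡ true → a ≡ true) → a ≡ b
≡true-ext {true}  {true}  _ _ = refl
≡true-ext {false} {false} _ _ = refl
≡true-ext {true}  {false} a⇒b _ = sym (a⇒b refl)
≡true-ext {false} {true}  _ b⇒a = b⇒a refl

Disjoint : Subset m → Subset m → Set
Disjoint S T = ∀ {k} → k ∈ S → k ∉ T

∪-mono : ∀ {p p′ q q′ : Subset m} → p ⊆ p′ → q ⊆ q′ → p ∪ q ⊆ p′ ∪ q′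
∪-mono {p = p} {q = q} p⊆p′ q⊆q′ k∈p∪q =
  x∈p∪q⁺ (Sum.map p⊆p′ q⊆q′ (x∈p∪q⁻ p q k∈p∪q))

∪-⊆ : ∀ {p q r : Subset m} → p ⊆ r → q ⊆ r → p ∪ q ⊆ r
∪-⊆ {p = p} {q} p⊆r q⊆r k∈p∪q = [ p⊆r , q⊆r ]′ (x∈p∪q⁻ p q k∈p∪q)

#-mono : ∀ {S S′ T T′ : Subset m} → S′ ⊆ S → T′ ⊆ T → Disjoint S T → Disjoint S′ T′
#-mono S′⊆S T′⊆T S#T k∈S′ k∈T′ = S#T (S′⊆S k∈S′) (T′⊆T k∈T′)

⁅⁆-⊆ : ∀ {i : Fin m} {p} → i ∈ p → ⁅ i ⁆ ⊆ p
⁅⁆-⊆ {i = i} {p} i∈p k∈⁅i⁆ = subst (_∈ p) (sym (x∈⁅y⁆⇒x≡y i k∈⁅i⁆)) i∈p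

∈─⇒∉ : ∀ (p q : Subset m) {k} → k ∈ p ─ q → k ∉ q
∈─⇒∉ (s ∷ p) (outside ∷ q) here ()
∈─⇒∉ (s ∷ p) (t       ∷ q) (there k∈p─q) (there k∈q) = ∈─⇒∉ p q k∈p─q k∈q

∩≡⊥⇒Disjoint : ∀ {α β : Subset m} → α ∩ β ≡ ⊥ → Disjoint α β
∩≡⊥⇒Disjoint α∩β≡⊥ k∈α k∈β = ∉⊥ (subst (_ ∈_) α∩β≡⊥ (x∈p∩q⁺ (k∈α , k∈β)))

Disjoint⇒∩≡⊥ : ∀ {α β : Subset m} → Disjoint α β → α ∩ β ≡ ⊥
Disjoint⇒∩≡⊥ {α = α} {β} α#β = Empty-unique λ (k , k∈α∩β) → uncurry α#β (x∈p∩q⁻ α β k∈α∩β)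

-- Polynomials over F₂ and their values on {0,1}^m

parity : (A → Bool) → List A → Bool
parity w = foldr (λ a b → w a xor b) false

parity-++ : ∀ (w : A → Bool) xs ys → parity w (xs ++ ys) ≡ parity w xs xor parity w ys
parity-++ w []       ys = refl
parity-++ w (x ∷ xs) ys =
  trans (cong (w x xor_) (parity-++ w xs ys)) (sym (𝔹.xor-assoc (w x) _ _))

parity-map : ∀ (w : B → Bool) (f : A → B) xs → parity w (map f xs) ≡ parity (w ∘ f) xs
parity-map w f []       = refl
parity-map w f (x ∷ xs) = cong (w (f x) xor_) (parity-map w f xs)

parity-cong : ∀ {w w′ : A → Bool} → w ≗ w′ → ∀ xs → parity w xs ≡ parity w′ xs
parity-cong w≗w′ []       = refl
parity-cong w≗w′ (x ∷ xs) = cong₂ _xor_ (w≗w′ x) (parity-cong w≗w′ xs)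

parity-cancel : ∀ (w : A → Bool) x ys zs → parity w (x ∷ ys ++ x ∷ zs) ≡ parity w (ys ++ zs)
parity-cancel w x ys zs = begin
  w x xor parity w (ys ++ x ∷ zs)                  ≡⟨ cong (w x xor_) (parity-++ w ys (x ∷ zs)) ⟩
  w x xor (parity w ys xor (w x xor parity w zs))  ≡⟨ cancel (w x) (parity w ys) (parity w zs) ⟩
  parity w ys xor parity w zs                      ≡⟨ parity-++ w ys zs ⟨
  parity w (ys ++ zs)                              ∎
  where
  open ≡-Reasoning
  cancel : ∀ a b c → a xor (b xor (a xor c)) ≡ b xor c
  cancel true  b c = trans (𝔹.not-distribʳ-xor b (not c)) (cong (b xor_) (𝔹.not-involutive c))
  cancel false b c = refl

parity-filter : ∀ {P : A → Set} (P? : Decidable P) (w : A → Bool) xs →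
                parity w (filter P? xs) ≡ parity (λ x → does (P? x) ∧ w x) xs
parity-filter P? w []       = refl
parity-filter P? w (x ∷ xs) with does (P? x)
... | true  = cong (w x xor_) (parity-filter P? w xs)
... | false = parity-filter P? w xs

_≡ᵐ_ : Mono m → Mono m → Bool
e ≡ᵐ e′ = does (Vec.≡-dec ℕ._≟_ e e′)

coeff-parity : ∀ (p : Poly m) e → coeff p e ≡ parity (_≡ᵐ e) p
coeff-parity []       e = refl
coeff-parity (e′ ∷ p) e =
  trans (if-not (Vec.≡-dec ℕ._≟_ e′ e) (coeff p e)) (cong ((e′ ≡ᵐ e) xor_) (coeff-parity p e))
  where
  if-not : ∀ {P : Set} (d : Dec P) b → (if ⌊ d ⌋ then not b else b) ≡ does d xor b
  if-not (true  because _) b = refl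
  if-not (false because _) b = refl

odd-coeff⇒∈ : ∀ (p : Poly m) e → coeff p e ≡ true → e ∈ₗ p
odd-coeff⇒∈ (e′ ∷ p) e h with Vec.≡-dec ℕ._≟_ e′ e
... | yes refl = here refl
... | no  _    = there (odd-coeff⇒∈ p e h)

coeff-self-∷ : ∀ (p : Poly m) e → coeff (e ∷ p) e ≡ not (coeff p e)
coeff-self-∷ p e with Vec.≡-dec ℕ._≟_ e e
... | yes _  = refl
... | no e≢e = ⊥-elim (e≢e refl)

-- The first monomial has even coefficient, so it occurs a second time and the pair cancels.
even-coeffs⇒parity-false : ∀ n (p : Poly m) → length p ≤ n → (∀ e → coeff p e ≡ false) →
                           ∀ w → parity w p ≡ false
even-coeffs⇒parity-false n       []      _           _    w = refl
even-coeffs⇒parity-false (suc n) (e ∷ p) (s≤s ∣p∣≤n) even w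
  with ys , zs , refl ← ∈-∃++ (odd-coeff⇒∈ p e (𝔹.not-injective (trans (sym (coeff-self-∷ p e)) (even e))))
  = trans (parity-cancel w e ys zs)
          (even-coeffs⇒parity-false n (ys ++ zs) shorter even′ w)
  where
  shorter : length (ys ++ zs) ≤ n
  shorter = ℕ.≤-trans (ℕ.n≤1+n _) (subst (_≤ n) (length-++-sucʳ ys e zs) ∣p∣≤n)
  even′ : ∀ e′ → coeff (ys ++ zs) e′ ≡ false
  even′ e′ = trans (coeff-parity (ys ++ zs) e′)
    (trans (sym (parity-cancel (_≡ᵐ e′) e ys zs))
           (trans (sym (coeff-parity (e ∷ ys ++ e ∷ zs) e′)) (even e′)))

coeff-++ : ∀ (p q : Poly m) e → coeff (p ++ q) e ≡ coeff p e xor coeff q e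
coeff-++ p q e = begin
  coeff (p ++ q) e                        ≡⟨ coeff-parity (p ++ q) e ⟩
  parity (_≡ᵐ e) (p ++ q)                 ≡⟨ parity-++ (_≡ᵐ e) p q ⟩
  parity (_≡ᵐ e) p xor parity (_≡ᵐ e) q   ≡⟨ cong₂ _xor_ (coeff-parity p e) (coeff-parity q e) ⟨
  coeff p e xor coeff q e                 ∎
  where open ≡-Reasoning

≈ₚ⇒parity≡ : ∀ {p q : Poly m} → p ≈ₚ q → ∀ w → parity w p ≡ parity w q
≈ₚ⇒parity≡ {p = p} {q} p≈q w = xor≡false⇒≡ (trans (sym (parity-++ w p q))
  (even-coeffs⇒parity-false _ (p ++ q) ℕ.≤-refl
    (λ e → trans (coeff-++ p q e) (trans (cong (_xor coeff q e) (p≈q e)) (𝔹.xor-same (coeff q e)))) w))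

_^ᵇ_ : Bool → ℕ → Bool
c ^ᵇ zero  = true
c ^ᵇ suc _ = c

^ᵇ-+ : ∀ c k l → c ^ᵇ (k + l) ≡ c ^ᵇ k ∧ c ^ᵇ l
^ᵇ-+ c zero    l       = refl
^ᵇ-+ c (suc k) zero    = sym (𝔹.∧-identityʳ c)
^ᵇ-+ c (suc k) (suc l) = sym (𝔹.∧-idem c)

evalMono : Mono m → Subset m → Bool
evalMono []      []      = true
evalMono (k ∷ e) (c ∷ x) = c ^ᵇ k ∧ evalMono e x

eval : Poly m → Subset m → Bool
eval p x = parity (λ e → evalMono e x) p

≈ₚ⇒eval≡ : ∀ {p q : Poly m} → p ≈ₚ q → ∀ x → eval p x ≡ eval q x
≈ₚ⇒eval≡ {p = p} {q} p≈q x = ≈ₚ⇒parity≡ {p = p} {q} p≈q (λ e → evalMono e x)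

eval-+ₚ : ∀ (p q : Poly m) x → eval (p +ₚ q) x ≡ eval p x xor eval q x
eval-+ₚ p q x = parity-++ (λ e → evalMono e x) p q

evalMono-+ : ∀ (a b : Mono m) x → evalMono (zipWith _+_ a b) x ≡ evalMono a x ∧ evalMono b x
evalMono-+ []      []      []      = refl
evalMono-+ (k ∷ a) (l ∷ b) (c ∷ x) =
  trans (cong₂ _∧_ (^ᵇ-+ c k l) (evalMono-+ a b x)) (∧-interchange (c ^ᵇ k) (c ^ᵇ l) _ _)

eval-*ₚ : ∀ (p q : Poly m) x → eval (p *ₚ q) x ≡ eval p x ∧ eval q x
eval-*ₚ []      q x = refl
eval-*ₚ (a ∷ p) q x = begin
  eval (map (zipWith _+_ a) q ++ p *ₚ q) x
    ≡⟨ eval-+ₚ (map (zipWith _+_ a) q) (p *ₚ q) x ⟩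
  eval (map (zipWith _+_ a) q) x xor eval (p *ₚ q) x
    ≡⟨ cong₂ _xor_ (eval-shift q) (eval-*ₚ p q x) ⟩
  (evalMono a x ∧ eval q x) xor (eval p x ∧ eval q x)
    ≡⟨ 𝔹.∧-distribʳ-xor (eval q x) (evalMono a x) (eval p x) ⟨
  eval (a ∷ p) x ∧ eval q x ∎
  where
  open ≡-Reasoning
  eval-shift : ∀ q → eval (map (zipWith _+_ a) q) x ≡ evalMono a x ∧ eval q x
  eval-shift []      = sym (𝔹.∧-zeroʳ (evalMono a x))
  eval-shift (b ∷ q) = trans (cong₂ _xor_ (evalMono-+ a b x) (eval-shift q))
                             (sym (𝔹.∧-distribˡ-xor (evalMono a x) (evalMono b x) (eval q x)))

eval-oneₚ : ∀ (x : Subset m) → eval oneₚ x ≡ true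
eval-oneₚ []      = refl
eval-oneₚ (c ∷ x) = eval-oneₚ x

eval-var : ∀ (i : Fin m) x → eval (var i) x ≡ lookup x i
eval-var i x = trans (𝔹.xor-identityʳ _) (evalMono-var i x)
  where
  evalMono-zero : ∀ {m} (x : Subset m) → evalMono (tabulate (λ _ → 0)) x ≡ true
  evalMono-zero []      = refl
  evalMono-zero (c ∷ x) = evalMono-zero x
  evalMono-var : ∀ {m} (i : Fin m) x →
                 evalMono (tabulate (λ j → if ⌊ i Fin.≟ j ⌋ then 1 else 0)) x ≡ lookup x i
  evalMono-var fzero    (c ∷ x) = trans (cong (c ∧_) (evalMono-zero x)) (𝔹.∧-identityʳ c)
  evalMono-var (fsuc i) (c ∷ x) =
    trans (cong (λ v → evalMono v x)
                (Vec.tabulate-cong (λ j → cong (λ b → if b then 1 else 0) (⌊⌋-map′ _ _ (i Fin.≟ j)))))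
          (evalMono-var i x)

eval-embedP : ∀ (p : Poly m) x d → eval (embedP p) (x ∷ʳ d) ≡ eval p x
eval-embedP p x d =
  trans (parity-map (λ e → evalMono e (x ∷ʳ d)) (_∷ʳ 0) p) (parity-cong (λ e → evalMono-∷ʳ0 e x) p)
  where
  evalMono-∷ʳ0 : ∀ {m} (e : Mono m) x → evalMono (e ∷ʳ 0) (x ∷ʳ d) ≡ evalMono e x
  evalMono-∷ʳ0 []      []      = refl
  evalMono-∷ʳ0 (k ∷ e) (c ∷ x) = cong (c ^ᵇ k ∧_) (evalMono-∷ʳ0 e x)

eval-var⁺ : ∀ {i : Fin m} {x} → i ∈ x → eval (var i) x ≡ true
eval-var⁺ {i = i} {x} i∈x = trans (eval-var i x) (Vec.[]=⇒lookup i∈x)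

eval-var⁻ : ∀ {i : Fin m} {x} → eval (var i) x ≡ true → i ∈ x
eval-var⁻ {i = i} {x} eq = Vec.lookup⇒[]= i x (trans (sym (eval-var i x)) eq)

eval-1+var⁺ : ∀ {i : Fin m} {x} → i ∉ x → eval (oneₚ +ₚ var i) x ≡ true
eval-1+var⁺ {i = i} {x} i∉x = trans (eval-+ₚ oneₚ (var i) x)
  (cong₂ _xor_ (eval-oneₚ x) (trans (eval-var i x) (𝔹.¬-not (i∉x ∘ Vec.lookup⇒[]= i x))))

eval-1+var⁻ : ∀ {i : Fin m} {x} → eval (oneₚ +ₚ var i) x ≡ true → i ∉ x
eval-1+var⁻ {i = i} {x} eq i∈x with () ← trans (sym eq)
  (trans (eval-+ₚ oneₚ (var i) x) (cong₂ _xor_ (eval-oneₚ x) (eval-var⁺ i∈x)))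

-- Multilinear polynomials

Multilinear : Mono m → Set
Multilinear e = ∀ k → lookup e k ≤ 1

-- p = slice₀ p + x₀ · slice₁ p for multilinear p
slice₀ slice₁ : Poly (suc m) → Poly m
slice₀ []                  = []
slice₀ ((zero  ∷ e) ∷ p)   = e ∷ slice₀ p
slice₀ ((suc _ ∷ e) ∷ p)   = slice₀ p
slice₁ []                  = []
slice₁ ((zero  ∷ e) ∷ p)   = slice₁ p
slice₁ ((1     ∷ e) ∷ p)   = e ∷ slice₁ p
slice₁ ((suc (suc _) ∷ e) ∷ p) = slice₁ p

multilinear-tail : ∀ {k} {e : Mono m} → Multilinear (k ∷ e) → Multilinear e
multilinear-tail ml k = ml (fsuc k)

slice₀-multilinear : ∀ (p : Poly (suc m)) → All Multilinear p → All Multilinear (slice₀ p)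
slice₀-multilinear []                []         = []
slice₀-multilinear ((zero  ∷ e) ∷ p) (ml ∷ mls) = multilinear-tail ml ∷ slice₀-multilinear p mls
slice₀-multilinear ((suc _ ∷ e) ∷ p) (ml ∷ mls) = slice₀-multilinear p mls

slice₁-multilinear : ∀ (p : Poly (suc m)) → All Multilinear p → All Multilinear (slice₁ p)
slice₁-multilinear []                       []         = []
slice₁-multilinear ((zero  ∷ e) ∷ p)        (ml ∷ mls) = slice₁-multilinear p mls
slice₁-multilinear ((1 ∷ e) ∷ p)            (ml ∷ mls) = multilinear-tail ml ∷ slice₁-multilinear p mls
slice₁-multilinear ((suc (suc _) ∷ e) ∷ p)  (ml ∷ mls) with ml fzero
... | s≤s ()

eval-slices : ∀ (p : Poly (suc m)) → All Multilinear p → ∀ c x →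
              eval p (c ∷ x) ≡ eval (slice₀ p) x xor (c ∧ eval (slice₁ p) x)
eval-slices []                      []         c x = sym (𝔹.∧-zeroʳ c)
eval-slices ((zero ∷ e) ∷ p)        (ml ∷ mls) c x =
  trans (cong (evalMono e x xor_) (eval-slices p mls c x)) (sym (𝔹.xor-assoc (evalMono e x) _ _))
eval-slices ((1 ∷ e) ∷ p)           (ml ∷ mls) c x =
  trans (cong (c ∧ evalMono e x xor_) (eval-slices p mls c x))
        (trans (xor-swap (c ∧ evalMono e x) (eval (slice₀ p) x) (c ∧ eval (slice₁ p) x))
               (cong (eval (slice₀ p) x xor_) (sym (𝔹.∧-distribˡ-xor c (evalMono e x) (eval (slice₁ p) x)))))
eval-slices ((suc (suc _) ∷ e) ∷ p) (ml ∷ mls) c x with ml fzero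
... | s≤s ()

parity-slice₀ : ∀ (p : Poly (suc m)) e → parity (_≡ᵐ (0 ∷ e)) p ≡ parity (_≡ᵐ e) (slice₀ p)
parity-slice₀ []                 e = refl
parity-slice₀ ((zero  ∷ e′) ∷ p) e = cong ((e′ ≡ᵐ e) xor_) (parity-slice₀ p e)
parity-slice₀ ((suc _ ∷ e′) ∷ p) e = parity-slice₀ p e

parity-slice₁ : ∀ (p : Poly (suc m)) e → parity (_≡ᵐ (1 ∷ e)) p ≡ parity (_≡ᵐ e) (slice₁ p)
parity-slice₁ []                        e = refl
parity-slice₁ ((zero ∷ e′) ∷ p)         e = parity-slice₁ p e
parity-slice₁ ((1 ∷ e′) ∷ p)            e = cong ((e′ ≡ᵐ e) xor_) (parity-slice₁ p e)
parity-slice₁ ((suc (suc _) ∷ e′) ∷ p)  e = parity-slice₁ p e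

parity-non-multilinear : ∀ (p : Poly (suc m)) → All Multilinear p → ∀ k e →
                         parity (_≡ᵐ (suc (suc k) ∷ e)) p ≡ false
parity-non-multilinear []                       []         k e = refl
parity-non-multilinear ((zero ∷ e′) ∷ p)        (_  ∷ mls) k e = parity-non-multilinear p mls k e
parity-non-multilinear ((1 ∷ e′) ∷ p)           (_  ∷ mls) k e = parity-non-multilinear p mls k e
parity-non-multilinear ((suc (suc _) ∷ e′) ∷ p) (ml ∷ mls) k e with ml fzero
... | s≤s ()

slices-vanish : ∀ (p : Poly (suc m)) → All Multilinear p → (∀ x → eval p x ≡ false) →
                (∀ x → eval (slice₀ p) x ≡ false) × (∀ x → eval (slice₁ p) x ≡ false)
slices-vanish p mls vanish = vanish₀ , vanish₁
  where
  vanish₀ : ∀ x → eval (slice₀ p) x ≡ false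
  vanish₀ x = trans (sym (𝔹.xor-identityʳ _)) (trans (sym (eval-slices p mls false x)) (vanish (false ∷ x)))
  vanish₁ : ∀ x → eval (slice₁ p) x ≡ false
  vanish₁ x = trans (cong (_xor eval (slice₁ p) x) (sym (vanish₀ x)))
                    (trans (sym (eval-slices p mls true x)) (vanish (true ∷ x)))

multilinear-vanishing⇒even : ∀ m (p : Poly m) → All Multilinear p → (∀ x → eval p x ≡ false) →
                 ∀ e → parity (_≡ᵐ e) p ≡ false
multilinear-vanishing⇒even zero    p mls vanish [] =
  trans (parity-cong {w = _≡ᵐ []} {w′ = λ e → evalMono e []} (λ { [] → refl }) p) (vanish [])
multilinear-vanishing⇒even (suc m) p mls vanish (zero ∷ e) =
  trans (parity-slice₀ p e)
        (multilinear-vanishing⇒even m (slice₀ p) (slice₀-multilinear p mls)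
                                    (proj₁ (slices-vanish p mls vanish)) e)
multilinear-vanishing⇒even (suc m) p mls vanish (1 ∷ e) =
  trans (parity-slice₁ p e)
        (multilinear-vanishing⇒even m (slice₁ p) (slice₁-multilinear p mls)
                                    (proj₂ (slices-vanish p mls vanish)) e)
multilinear-vanishing⇒even (suc m) p mls vanish (suc (suc k) ∷ e) = parity-non-multilinear p mls k e

multilinear-≈ₚ : ∀ (p q : Poly m) → All Multilinear p → All Multilinear q →
                 (∀ x → eval p x ≡ eval q x) → p ≈ₚ q
multilinear-≈ₚ {m} p q mlp mlq p≗q e = xor≡false⇒≡ (begin
  coeff p e xor coeff q e   ≡⟨ coeff-++ p q e ⟨
  coeff (p ++ q) e          ≡⟨ coeff-parity (p ++ q) e ⟩
  parity (_≡ᵐ e) (p ++ q)   ≡⟨ multilinear-vanishing⇒even m (p ++ q) (Allₚ.++⁺ mlp mlq) vanish e ⟩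
  false                     ∎)
  where
  open ≡-Reasoning
  vanish : ∀ x → eval (p ++ q) x ≡ false
  vanish x = trans (eval-+ₚ p q x) (trans (cong (_xor eval q x) (p≗q x)) (𝔹.xor-same (eval q x)))

SupportedOn : Subset m → Mono m → Set
SupportedOn S e = ∀ k → lookup e k ≡ 0 ⊎ (lookup e k ≡ 1 × k ∈ S)

supported⇒multilinear : ∀ {S : Subset m} {p} → All (SupportedOn S) p → All Multilinear p
supported⇒multilinear = All.map λ supp k →
  [ (λ e≡0 → ℕ.≤-trans (ℕ.≤-reflexive e≡0) z≤n) , (λ (e≡1 , _) → ℕ.≤-reflexive e≡1) ]′ (supp k)

supported-mono : ∀ {S T : Subset m} → S ⊆ T → ∀ {p} → All (SupportedOn S) p → All (SupportedOn T) p
supported-mono S⊆T = All.map λ supp k → Sum.map₂ (Product.map₂ S⊆T) (supp k)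

supported-oneₚ : All (SupportedOn {m} ⊥) oneₚ
supported-oneₚ = (λ k → inj₁ (Vec.lookup-replicate k 0)) ∷ []

supported-var : ∀ (i : Fin m) → All (SupportedOn ⁅ i ⁆) (var i)
supported-var i =
  (λ k → subst (λ n → n ≡ 0 ⊎ (n ≡ 1 × k ∈ ⁅ i ⁆)) (sym (Vec.lookup∘tabulate _ k)) (entry k)) ∷ []
  where
  entry : ∀ k → (if ⌊ i Fin.≟ k ⌋ then 1 else 0) ≡ 0 ⊎ ((if ⌊ i Fin.≟ k ⌋ then 1 else 0) ≡ 1 × k ∈ ⁅ i ⁆)
  entry k with i Fin.≟ k
  ... | yes refl = inj₂ (refl , x∈⁅x⁆ i)
  ... | no  _    = inj₁ refl

supported-+ : ∀ {S T : Subset m} {a b} → Disjoint S T →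
              SupportedOn S a → SupportedOn T b → SupportedOn (S ∪ T) (zipWith _+_ a b)
supported-+ {S = S} {T} {a} {b} S#T suppa suppb k =
  subst (λ n → n ≡ 0 ⊎ (n ≡ 1 × k ∈ S ∪ T)) (sym (Vec.lookup-zipWith _+_ k a b)) (sum (suppa k) (suppb k))
  where
  sum : ∀ {u v} → u ≡ 0 ⊎ (u ≡ 1 × k ∈ S) → v ≡ 0 ⊎ (v ≡ 1 × k ∈ T) → u + v ≡ 0 ⊎ (u + v ≡ 1 × k ∈ S ∪ T)
  sum (inj₁ refl)        (inj₁ refl)        = inj₁ refl
  sum (inj₁ refl)        (inj₂ (refl , k∈T)) = inj₂ (refl , x∈p∪q⁺ (inj₂ k∈T))
  sum (inj₂ (refl , k∈S)) (inj₁ refl)        = inj₂ (refl , x∈p∪q⁺ (inj₁ k∈S))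
  sum (inj₂ (_ , k∈S))   (inj₂ (_ , k∈T))   = ⊥-elim (S#T k∈S k∈T)

supported-*ₚ : ∀ {S T : Subset m} {p q} → Disjoint S T →
               All (SupportedOn S) p → All (SupportedOn T) q → All (SupportedOn (S ∪ T)) (p *ₚ q)
supported-*ₚ         S#T []              suppq = []
supported-*ₚ {p = a ∷ _} S#T (suppa ∷ suppp) suppq =
  Allₚ.++⁺ (Allₚ.map⁺ (All.map (λ {b} → supported-+ {a = a} {b} S#T suppa) suppq))
          (supported-*ₚ S#T suppp suppq)

-- Pseudo-monomials and their boxes

shiftₚ : Poly m → Poly (suc m)
shiftₚ = map (0 ∷_)

shiftₚ-*ₚ : ∀ (p q : Poly m) → shiftₚ p *ₚ shiftₚ q ≡ shiftₚ (p *ₚ q)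
shiftₚ-*ₚ []      q = refl
shiftₚ-*ₚ (a ∷ p) q = trans (cong₂ _++_ (shift-row q) (shiftₚ-*ₚ p q))
                            (sym (Listₚ.map-++ (0 ∷_) (map (zipWith _+_ a) q) (p *ₚ q)))
  where
  shift-row : ∀ q → map (zipWith _+_ (0 ∷ a)) (shiftₚ q) ≡ shiftₚ (map (zipWith _+_ a) q)
  shift-row []      = refl
  shift-row (b ∷ q) = cong (_ ∷_) (shift-row q)

shiftₚ-var : ∀ (i : Fin m) → var (fsuc i) ≡ shiftₚ (var i)
shiftₚ-var i = cong (λ e → (0 ∷ e) ∷ [])
  (Vec.tabulate-cong (λ j → cong (λ b → if b then 1 else 0) (⌊⌋-map′ _ _ (i Fin.≟ j))))

eval-shiftₚ : ∀ (p : Poly m) c x → eval (shiftₚ p) (c ∷ x) ≡ eval p x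
eval-shiftₚ p c x = parity-map (λ e → evalMono e (c ∷ x)) (0 ∷_) p

supported-shiftₚ : ∀ {S : Subset m} {p} → All (SupportedOn S) p → All (SupportedOn (outside ∷ S)) (shiftₚ p)
supported-shiftₚ supp = Allₚ.map⁺ (All.map shift supp)
  where
  shift : ∀ {e} → SupportedOn _ e → SupportedOn (outside ∷ _) (0 ∷ e)
  shift suppe fzero    = inj₁ refl
  shift suppe (fsuc k) = Sum.map₂ (Product.map₂ there) (suppe k)

factor : Subset m → Subset m → Fin m → Poly m
factor α β i = (if lookup α i then var i else oneₚ) *ₚ (if lookup β i then oneₚ +ₚ var i else oneₚ)

factor-fsuc : ∀ a b (α β : Subset m) i → factor (a ∷ α) (b ∷ β) (fsuc i) ≡ shiftₚ (factor α β i)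
factor-fsuc a b α β i with lookup α i | lookup β i
... | true  | true  = trans (cong (λ v → v *ₚ (oneₚ +ₚ v)) (shiftₚ-var i)) (shiftₚ-*ₚ (var i) (oneₚ +ₚ var i))
... | true  | false = trans (cong (_*ₚ oneₚ) (shiftₚ-var i)) (shiftₚ-*ₚ (var i) oneₚ)
... | false | true  = trans (cong (λ v → oneₚ *ₚ (oneₚ +ₚ v)) (shiftₚ-var i)) (shiftₚ-*ₚ oneₚ (oneₚ +ₚ var i))
... | false | false = shiftₚ-*ₚ oneₚ oneₚ

pm-∷ : ∀ a b (α β : Subset m) → pm (a ∷ α) (b ∷ β) ≡ factor (a ∷ α) (b ∷ β) fzero *ₚ shiftₚ (pm α β)
pm-∷ {m} a b α β = cong (factor (a ∷ α) (b ∷ β) fzero *ₚ_) (product-fsuc (λ i → i))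
  where
  product-fsuc : ∀ {k} (g : Fin k → Fin m) →
    foldr (λ i acc → factor (a ∷ α) (b ∷ β) i *ₚ acc) oneₚ (List.tabulate (fsuc ∘ g))
    ≡ shiftₚ (foldr (λ i acc → factor α β i *ₚ acc) oneₚ (List.tabulate g))
  product-fsuc {zero}  g = refl
  product-fsuc {suc k} g = trans (cong₂ _*ₚ_ (factor-fsuc a b α β (g fzero)) (product-fsuc (g ∘ fsuc)))
                                 (shiftₚ-*ₚ (factor α β (g fzero)) _)

literal : Bool → Bool → Bool → Bool
literal a b c = (if a then c else true) ∧ (if b then not c else true)

inBox? : Subset m → Subset m → Subset m → Bool
inBox? []      []      []      = true
inBox? (a ∷ α) (b ∷ β) (c ∷ x) = literal a b c ∧ inBox? α β x

eval-pm : ∀ (α β x : Subset m) → eval (pm α β) x ≡ inBox? α β x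
eval-pm []      []      []      = refl
eval-pm (a ∷ α) (b ∷ β) (c ∷ x) = begin
  eval (pm (a ∷ α) (b ∷ β)) (c ∷ x)                   ≡⟨ cong (λ p → eval p (c ∷ x)) (pm-∷ a b α β) ⟩
  eval (head *ₚ shiftₚ (pm α β)) (c ∷ x)              ≡⟨ eval-*ₚ head (shiftₚ (pm α β)) (c ∷ x) ⟩
  eval head (c ∷ x) ∧ eval (shiftₚ (pm α β)) (c ∷ x)  ≡⟨ cong₂ _∧_ eval-head (eval-shiftₚ (pm α β) c x) ⟩
  literal a b c ∧ eval (pm α β) x                     ≡⟨ cong (literal a b c ∧_) (eval-pm α β x) ⟩
  literal a b c ∧ inBox? α β x                        ∎
  where
  open ≡-Reasoning
  head : Poly (suc _)
  head = factor (a ∷ α) (b ∷ β) fzero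
  eval-head : eval head (c ∷ x) ≡ literal a b c
  eval-head = trans (eval-*ₚ (if a then var fzero else oneₚ) (if b then oneₚ +ₚ var fzero else oneₚ) (c ∷ x))
                    (cong₂ _∧_ (eval-x a) (eval-1-x b))
    where
    eval-x : ∀ a → eval (if a then var fzero else oneₚ) (c ∷ x) ≡ (if a then c else true)
    eval-x true  = eval-var fzero (c ∷ x)
    eval-x false = eval-oneₚ (c ∷ x)
    eval-1-x : ∀ b → eval (if b then oneₚ +ₚ var fzero else oneₚ) (c ∷ x) ≡ (if b then not c else true)
    eval-1-x true  = trans (eval-+ₚ oneₚ (var fzero) (c ∷ x))
                           (cong₂ _xor_ (eval-oneₚ (c ∷ x)) (eval-var fzero (c ∷ x)))
    eval-1-x false = eval-oneₚ (c ∷ x)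

-- Box α β is the set where pm α β takes the value 1.
Box : Subset m → Subset m → Subset m → Set
Box α β x = α ⊆ x × Disjoint β x

Literal : Bool → Bool → Bool → Set
Literal a b c = (a ≡ true → c ≡ true) × (b ≡ true → c ≡ false)

literal⇒Literal : ∀ a b c → literal a b c ≡ true → Literal a b c
literal⇒Literal true  true  true  ()
literal⇒Literal true  true  false ()
literal⇒Literal true  false c     c≡true = (λ _ → trans (sym (𝔹.∧-identityʳ c)) c≡true) , λ ()
literal⇒Literal false true  c     ¬c≡true = (λ ()) , λ _ → 𝔹.not-injective ¬c≡true
literal⇒Literal false false c     _ = (λ ()) , λ ()

Literal⇒literal : ∀ a b c → Literal a b c → literal a b c ≡ true
Literal⇒literal true  b     c (ac , bc) with ac refl
Literal⇒literal true  true  c (ac , bc) | refl with bc refl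
... | ()
Literal⇒literal true  false c (ac , bc) | refl = refl
Literal⇒literal false true  c (ac , bc) = cong not (bc refl)
Literal⇒literal false false c (ac , bc) = refl

∷-⊆⁺ : ∀ {a c} {α x : Subset m} → (a ≡ true → c ≡ true) → α ⊆ x → a ∷ α ⊆ c ∷ x
∷-⊆⁺ {c = true} ac α⊆x here = here
∷-⊆⁺ {c = false} ac α⊆x here with ac refl
... | ()
∷-⊆⁺ ac α⊆x (there k∈α) = there (α⊆x k∈α)

∷-⊆⁻ : ∀ {a c} {α x : Subset m} → a ∷ α ⊆ c ∷ x → a ≡ true → c ≡ true
∷-⊆⁻ a∷α⊆c∷x refl = Vec.[]=⇒lookup (a∷α⊆c∷x here)

∷-#⁺ : ∀ {b c} {β x : Subset m} → (b ≡ true → c ≡ false) → Disjoint β x → Disjoint (b ∷ β) (c ∷ x)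
∷-#⁺ bc β#x here here with bc refl
... | ()
∷-#⁺ bc β#x (there k∈β) (there k∈x) = β#x k∈β k∈x

∷-#⁻ : ∀ {b c} {β x : Subset m} → Disjoint (b ∷ β) (c ∷ x) → b ≡ true → c ≡ false
∷-#⁻ {c = true}  b∷β#c∷x refl = ⊥-elim (b∷β#c∷x here here)
∷-#⁻ {c = false} b∷β#c∷x refl = refl

Box-∷⁺ : ∀ {a b c} {α β x : Subset m} → Literal a b c → Box α β x → Box (a ∷ α) (b ∷ β) (c ∷ x)
Box-∷⁺ (ac , bc) (α⊆x , β#x) = ∷-⊆⁺ ac α⊆x , ∷-#⁺ bc β#x

Box-∷⁻ : ∀ {a b c} {α β x : Subset m} → Box (a ∷ α) (b ∷ β) (c ∷ x) → Literal a b c × Box α β x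
Box-∷⁻ (⊆ , #) = (∷-⊆⁻ ⊆ , ∷-#⁻ #) , drop-∷-⊆ ⊆ , λ k∈β k∈x → # (there k∈β) (there k∈x)

inBox?⇒Box : ∀ (α β x : Subset m) → inBox? α β x ≡ true → Box α β x
inBox?⇒Box []      []      []      _  = (λ ()) , λ ()
inBox?⇒Box (a ∷ α) (b ∷ β) (c ∷ x) eq =
  Box-∷⁺ (literal⇒Literal a b c (proj₁ (∧-true⁻ eq))) (inBox?⇒Box α β x (proj₂ (∧-true⁻ eq)))

Box⇒inBox? : ∀ (α β x : Subset m) → Box α β x → inBox? α β x ≡ true
Box⇒inBox? []      []      []      _   = refl
Box⇒inBox? (a ∷ α) (b ∷ β) (c ∷ x) box =
  ∧-true⁺ (Literal⇒literal a b c (proj₁ (Box-∷⁻ box))) (Box⇒inBox? α β x (proj₂ (Box-∷⁻ box)))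

eval-pm⇒Box : ∀ {α β x : Subset m} → eval (pm α β) x ≡ true → Box α β x
eval-pm⇒Box {α = α} {β} {x} eq = inBox?⇒Box α β x (trans (sym (eval-pm α β x)) eq)

Box⇒eval-pm : ∀ {α β x : Subset m} → Box α β x → eval (pm α β) x ≡ true
Box⇒eval-pm {α = α} {β} {x} box = trans (eval-pm α β x) (Box⇒inBox? α β x box)

pm-supported : ∀ (α β : Subset m) → Disjoint α β → All (SupportedOn (α ∪ β)) (pm α β)
pm-supported []      []      _ = (λ ()) ∷ []
pm-supported (a ∷ α) (b ∷ β) a∷α#b∷β =
  subst (All (SupportedOn ((a ∷ α) ∪ (b ∷ β)))) (sym (pm-∷ a b α β))
    (supported-mono (∪-mono-∷ a b)
      (supported-*ₚ (#-mono (head⊆ a b) ⊆-refl head#tail)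
        (supported-*ₚ (∷-#⁺ (∷-#⁻ a∷α#b∷β) (λ _ → ∉⊥)) (x-part a) (1-x-part b))
        (supported-shiftₚ (pm-supported α β (λ k∈α k∈β → a∷α#b∷β (there k∈α) (there k∈β))))))
  where
  x-part : ∀ a → All (SupportedOn (a ∷ ⊥)) (if a then var fzero else oneₚ)
  x-part true  = supported-var fzero
  x-part false = supported-oneₚ
  1-x-part : ∀ b → All (SupportedOn (b ∷ ⊥)) (if b then oneₚ +ₚ var fzero else oneₚ)
  1-x-part true  = Allₚ.++⁺ (supported-mono ⊥⊆ supported-oneₚ) (supported-var fzero)
  1-x-part false = supported-oneₚ
  head⊆ : ∀ a b → (a ∷ ⊥) ∪ (b ∷ ⊥) ⊆ inside ∷ (⊥ {m})
  head⊆ a b {fzero}  _              = here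
  head⊆ a b {fsuc k} (there k∈⊥∪⊥) = ⊥-elim ([ ∉⊥ , ∉⊥ ]′ (x∈p∪q⁻ ⊥ ⊥ k∈⊥∪⊥))
  head#tail : Disjoint (inside ∷ ⊥) (outside ∷ (α ∪ β))
  head#tail (there k∈⊥) _ = ∉⊥ k∈⊥
  ∪-mono-∷ : ∀ a b → ((a ∷ ⊥) ∪ (b ∷ ⊥)) ∪ (outside ∷ (α ∪ β)) ⊆ (a ∷ α) ∪ (b ∷ β)
  ∪-mono-∷ a b = ∪-⊆ {p = (a ∷ ⊥) ∪ (b ∷ ⊥)}
    (∪-mono {p = a ∷ ⊥} {a ∷ α} {b ∷ ⊥} {b ∷ β} (∷-⊆⁺ id ⊥⊆) (∷-⊆⁺ id ⊥⊆))
    (∪-mono {p = outside ∷ α} {a ∷ α} {outside ∷ β} {b ∷ β} (∷-⊆⁺ (λ ()) ⊆-refl) (∷-⊆⁺ (λ ()) ⊆-refl))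

pm-multilinear : ∀ {α β : Subset m} → Disjoint α β → All Multilinear (pm α β)
pm-multilinear {α = α} {β} α#β = supported⇒multilinear (pm-supported α β α#β)

pm-≈ₚ : ∀ {α β : Subset m} {p} → Disjoint α β → All Multilinear p →
        (∀ x → Box α β x → eval p x ≡ true) → (∀ x → eval p x ≡ true → Box α β x) → pm α β ≈ₚ p
pm-≈ₚ {α = α} {β} {p} α#β mlp box⇒p p⇒box = multilinear-≈ₚ (pm α β) p (pm-multilinear α#β) mlp
  λ x → ≡true-ext (box⇒p x ∘ eval-pm⇒Box) (Box⇒eval-pm ∘ p⇒box x)

Box-self : ∀ {α β : Subset m} → Disjoint α β → Box α β α
Box-self α#β = ⊆-refl , λ k∈β k∈α → α#β k∈α k∈β

Box-⊆ : ∀ {α β α′ β′ : Subset m} → α′ ⊆ α → β′ ⊆ β → ∀ {x} → Box α β x → Box α′ β′ x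
Box-⊆ α′⊆α β′⊆β (α⊆x , β#x) = α⊆x ∘ α′⊆α , β#x ∘ β′⊆β

Box-⊆⁻ : ∀ {α β α′ β′ : Subset m} → Disjoint α β → (∀ {x} → Box α β x → Box α′ β′ x) → α′ ⊆ α × β′ ⊆ β
Box-⊆⁻ {α = α} {β} {α′} {β′} α#β box⊆box′ = proj₁ (box⊆box′ (Box-self α#β)) , β′⊆β
  where
  β′⊆β : β′ ⊆ β
  β′⊆β {k} k∈β′ with k ∈? β
  ... | yes k∈β = k∈β
  ... | no  k∉β = ⊥-elim (proj₂ (box⊆box′ box) k∈β′ (x∈p∪q⁺ (inj₂ (x∈⁅x⁆ k))))
    where
    box : Box α β (α ∪ ⁅ k ⁆)
    box = p⊆p∪q ⁅ k ⁆ , λ {j} j∈β j∈α∪k →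
      [ (λ j∈α → α#β j∈α j∈β) , (λ j∈k → k∉β (subst (_∈ β) (x∈⁅y⁆⇒x≡y k j∈k) j∈β)) ]′ (x∈p∪q⁻ α ⁅ k ⁆ j∈α∪k)

pm-∣ₚ : ∀ {α β α′ β′ : Subset m} → α′ ⊆ α → β′ ⊆ β → Disjoint α β → pm α′ β′ ∣ₚ pm α β
pm-∣ₚ {α = α} {β} {α′} {β′} α′⊆α β′⊆β α#β = pm (α ─ α′) (β ─ β′) ,
  pm-≈ₚ α#β multilinear
    (λ x box → trans (eval-*ₚ (pm (α ─ α′) (β ─ β′)) (pm α′ β′) x)
      (∧-true⁺ (Box⇒eval-pm (Box-⊆ (p─q⊆p α α′) (p─q⊆p β β′) box)) (Box⇒eval-pm (Box-⊆ α′⊆α β′⊆β box))))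
    (λ x eq → let both = ∧-true⁻ (trans (sym (eval-*ₚ (pm (α ─ α′) (β ─ β′)) (pm α′ β′) x)) eq)
              in glue (eval-pm⇒Box (proj₁ both)) (eval-pm⇒Box (proj₂ both)))
  where
  quotient#divisor : Disjoint ((α ─ α′) ∪ (β ─ β′)) (α′ ∪ β′)
  quotient#divisor {k} k∈q k∈d with x∈p∪q⁻ (α ─ α′) (β ─ β′) k∈q | x∈p∪q⁻ α′ β′ k∈d
  ... | inj₁ k∈α─α′ | inj₁ k∈α′ = ∈─⇒∉ α α′ k∈α─α′ k∈α′
  ... | inj₁ k∈α─α′ | inj₂ k∈β′ = α#β (p─q⊆p α α′ k∈α─α′) (β′⊆β k∈β′)
  ... | inj₂ k∈β─β′ | inj₁ k∈α′ = α#β (α′⊆α k∈α′) (p─q⊆p β β′ k∈β─β′)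
  ... | inj₂ k∈β─β′ | inj₂ k∈β′ = ∈─⇒∉ β β′ k∈β─β′ k∈β′
  multilinear : All Multilinear (pm (α ─ α′) (β ─ β′) *ₚ pm α′ β′)
  multilinear = supported⇒multilinear (supported-*ₚ quotient#divisor
    (pm-supported (α ─ α′) (β ─ β′) (#-mono (p─q⊆p α α′) (p─q⊆p β β′) α#β))
    (pm-supported α′ β′ (#-mono α′⊆α β′⊆β α#β)))
  glue : ∀ {x} → Box (α ─ α′) (β ─ β′) x → Box α′ β′ x → Box α β x
  glue (⊆₁ , #₁) (⊆₂ , #₂) = α⊆x , β#x
    where
    α⊆x : α ⊆ _
    α⊆x {k} k∈α with k ∈? α′
    ... | yes k∈α′ = ⊆₂ k∈α′
    ... | no  k∉α′ = ⊆₁ (x∈p∧x∉q⇒x∈p─q k∈α k∉α′)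
    β#x : Disjoint β _
    β#x {k} k∈β with k ∈? β′
    ... | yes k∈β′ = #₂ k∈β′
    ... | no  k∉β′ = #₁ (x∈p∧x∉q⇒x∈p─q k∈β k∉β′)

¬Box⇒eval-pm : ∀ {α β x : Subset m} → ¬ Box α β x → eval (pm α β) x ≡ false
¬Box⇒eval-pm ¬box = 𝔹.¬-not (¬box ∘ eval-pm⇒Box)

Box? : ∀ (α β : Subset m) → Decidable (Box α β)
Box? α β x = Dec.map′ (inBox?⇒Box α β x ∘ Equivalence.to 𝔹.T-≡) (Equivalence.from 𝔹.T-≡ ∘ Box⇒inBox? α β x)
                      (T? (inBox? α β x))

Box-∁⇒≡ : ∀ {γ x : Subset m} → Box γ (∁ γ) x → x ≡ γ
Box-∁⇒≡ {γ = γ} (γ⊆x , ∁γ#x) = ⊆-antisym x⊆γ γ⊆x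
  where
  x⊆γ : _ ⊆ γ
  x⊆γ {k} k∈x with k ∈? γ
  ... | yes k∈γ = k∈γ
  ... | no  k∉γ = ⊥-elim (∁γ#x (x∉p⇒x∈∁p k∉γ) k∈x)

pm≈pm⇒Box⊆ : ∀ {α β α′ β′ : Subset m} → pm α β ≈ₚ pm α′ β′ → ∀ {x} → Box α β x → Box α′ β′ x
pm≈pm⇒Box⊆ {α = α} {β} {α′} {β′} pm≈pm′ {x} box =
  eval-pm⇒Box (trans (sym (≈ₚ⇒eval≡ {p = pm α β} {pm α′ β′} pm≈pm′ x)) (Box⇒eval-pm box))

∣ₚ⇒Box⊆ : ∀ {f g : Poly m} {α β α′ β′} → f ≈ₚ pm α β → g ≈ₚ pm α′ β′ → g ∣ₚ f →
          ∀ {x} → Box α β x → Box α′ β′ x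
∣ₚ⇒Box⊆ {f = f} {g} {α} {β} {α′} {β′} f≈pm g≈pm′ (h , f≈h*g) {x} box =
  eval-pm⇒Box (trans (sym (≈ₚ⇒eval≡ {p = g} {pm α′ β′} g≈pm′ x)) (proj₂ (∧-true⁻ h∧g)))
  where
  h∧g : eval h x ∧ eval g x ≡ true
  h∧g = trans (sym (eval-*ₚ h g x))
              (trans (sym (≈ₚ⇒eval≡ {p = f} {h *ₚ g} f≈h*g x))
                     (trans (≈ₚ⇒eval≡ {p = f} {pm α β} f≈pm x) (Box⇒eval-pm box)))

pm-injective : ∀ {α β α′ β′ : Subset m} → Disjoint α β → Disjoint α′ β′ → pm α β ≈ₚ pm α′ β′ → α ≡ α′ × β ≡ β′
pm-injective {α = α} {β} {α′} {β′} α#β α′#β′ pm≈pm′ =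
  ⊆-antisym (proj₁ ⊇) (proj₁ ⊆) , ⊆-antisym (proj₂ ⊇) (proj₂ ⊆)
  where
  ⊆ = Box-⊆⁻ α#β (pm≈pm⇒Box⊆ pm≈pm′)
  ⊇ = Box-⊆⁻ α′#β′ (pm≈pm⇒Box⊆ λ e → sym (pm≈pm′ e))

-- The ideal J_D and its canonical form

Avoids : Code m → Subset m → Subset m → Set
Avoids D α β = ∀ c → c ∈ᶜ D → ¬ Box α β c

linearCombination : List (Poly m × Poly m) → Poly m
linearCombination ps = concat (map (λ hg → proj₁ hg *ₚ proj₂ hg) ps)

InJ⇒vanishes : ∀ {D : Code m} {f} → InJ D f → ∀ c → c ∈ᶜ D → eval f c ≡ false
InJ⇒vanishes {D = D} {f} (ps , gens , f≈) c c∈D =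
  trans (≈ₚ⇒eval≡ {p = f} {linearCombination ps} f≈ c) (combination ps gens)
  where
  combination : ∀ ps → All (λ (hg : Poly _ × Poly _) → JGen D (proj₂ hg)) ps →
                eval (linearCombination ps) c ≡ false
  combination []             []                         = refl
  combination ((h , _) ∷ ps) ((γ , γ∉D , refl) ∷ gens) = begin
    eval (h *ₚ pm γ (∁ γ) +ₚ linearCombination ps) c
      ≡⟨ eval-+ₚ (h *ₚ pm γ (∁ γ)) (linearCombination ps) c ⟩
    eval (h *ₚ pm γ (∁ γ)) c xor eval (linearCombination ps) c
      ≡⟨ cong₂ _xor_ (eval-*ₚ h (pm γ (∁ γ)) c) (combination ps gens) ⟩
    (eval h c ∧ eval (pm γ (∁ γ)) c) xor false
      ≡⟨ cong (λ v → (eval h c ∧ v) xor false) (¬Box⇒eval-pm c∉box) ⟩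
    (eval h c ∧ false) xor false
      ≡⟨ cong (_xor false) (𝔹.∧-zeroʳ (eval h c)) ⟩
    false ∎
    where
    open ≡-Reasoning
    c∉box : ¬ Box γ (∁ γ) c
    c∉box box with () ← trans (sym c∈D) (trans (cong D (Box-∁⇒≡ box)) γ∉D)

subsets : ∀ m → List (Subset m)
subsets zero    = [] ∷ []
subsets (suc m) = map (outside ∷_) (subsets m) ++ map (inside ∷_) (subsets m)

-- Box γ (∁ γ) = {γ}, and every point occurs once in subsets m.
parity-points : ∀ m (b : Subset m → Bool) x → parity (λ γ → b γ ∧ inBox? γ (∁ γ) x) (subsets m) ≡ b x
parity-points zero    b [] = trans (𝔹.xor-identityʳ _) (𝔹.∧-identityʳ (b []))
parity-points (suc m) b (c ∷ x) = begin
  parity w (map (outside ∷_) (subsets m) ++ map (inside ∷_) (subsets m))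
    ≡⟨ parity-++ w (map (outside ∷_) (subsets m)) _ ⟩
  parity w (map (outside ∷_) (subsets m)) xor parity w (map (inside ∷_) (subsets m))
    ≡⟨ cong₂ _xor_ (parity-map w (outside ∷_) (subsets m)) (parity-map w (inside ∷_) (subsets m)) ⟩
  parity (w ∘ (outside ∷_)) (subsets m) xor parity (w ∘ (inside ∷_)) (subsets m)
    ≡⟨ cong₂ _xor_ (trans (parity-cong (λ γ → sym (𝔹.∧-assoc (b (outside ∷ γ)) (not c) _)) (subsets m))
                          (parity-points m (λ γ → b (outside ∷ γ) ∧ not c) x))
                   (trans (parity-cong (λ γ → trans (cong (λ v → b (inside ∷ γ) ∧ (v ∧ _)) (𝔹.∧-identityʳ c))
                                                     (sym (𝔹.∧-assoc (b (inside ∷ γ)) c _))) (subsets m))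
                          (parity-points m (λ γ → b (inside ∷ γ) ∧ c) x)) ⟩
  (b (outside ∷ x) ∧ not c) xor (b (inside ∷ x) ∧ c)
    ≡⟨ select c ⟩
  b (c ∷ x) ∎
  where
  open ≡-Reasoning
  w : Subset (suc m) → Bool
  w γ = b γ ∧ inBox? γ (∁ γ) (c ∷ x)
  select : ∀ c → (b (outside ∷ x) ∧ not c) xor (b (inside ∷ x) ∧ c) ≡ b (c ∷ x)
  select true  = trans (cong (_xor (b (inside ∷ x) ∧ true)) (𝔹.∧-zeroʳ (b (outside ∷ x)))) (𝔹.∧-identityʳ _)
  select false = trans (cong₂ _xor_ (𝔹.∧-identityʳ (b (outside ∷ x))) (𝔹.∧-zeroʳ (b (inside ∷ x))))
                       (𝔹.xor-identityʳ _)

pm-InJ : ∀ {D : Code m} {α β} → Disjoint α β → Avoids D α β → InJ D (pm α β)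
pm-InJ {m} {D} {α} {β} α#β avoid =
  map generator points , generators points (Allₚ.all-filter (Box? α β) (subsets m)) ,
  multilinear-≈ₚ (pm α β) (linearCombination (map generator points))
                 (pm-multilinear α#β) (multilinear points) values
  where
  points : List (Subset m)
  points = filter (Box? α β) (subsets m)
  generator : Subset m → Poly m × Poly m
  generator γ = oneₚ , pm γ (∁ γ)
  generators : ∀ γs → All (Box α β) γs → All (λ (hg : Poly m × Poly m) → JGen D (proj₂ hg)) (map generator γs)
  generators []       []            = []
  generators (γ ∷ γs) (box ∷ boxes) = (γ , 𝔹.¬-not (λ γ∈D → avoid γ γ∈D box) , refl) ∷ generators γs boxes
  multilinear : ∀ γs → All Multilinear (linearCombination (map generator γs))
  multilinear []       = []
  multilinear (γ ∷ γs) = Allₚ.++⁺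
    (supported⇒multilinear (supported-*ₚ (λ k∈⊥ _ → ∉⊥ k∈⊥) supported-oneₚ (pm-supported γ (∁ γ) x∈p⇒x∉∁p)))
    (multilinear γs)
  eval-combination : ∀ γs x →
    eval (linearCombination (map generator γs)) x ≡ parity (λ γ → inBox? γ (∁ γ) x) γs
  eval-combination []       x = refl
  eval-combination (γ ∷ γs) x =
    trans (eval-+ₚ (oneₚ *ₚ pm γ (∁ γ)) (linearCombination (map generator γs)) x)
          (cong₂ _xor_ (trans (eval-*ₚ oneₚ (pm γ (∁ γ)) x) (cong₂ _∧_ (eval-oneₚ x) (eval-pm γ (∁ γ) x)))
                       (eval-combination γs x))
  values : ∀ x → eval (pm α β) x ≡ eval (linearCombination (map generator points)) x
  values x = begin
    eval (pm α β) x                                             ≡⟨ eval-pm α β x ⟩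
    inBox? α β x                                                ≡⟨ parity-points m (inBox? α β) x ⟨
    parity (λ γ → inBox? α β γ ∧ inBox? γ (∁ γ) x) (subsets m)   ≡⟨ parity-filter (Box? α β) _ (subsets m) ⟨
    parity (λ γ → inBox? γ (∁ γ) x) points                      ≡⟨ eval-combination points x ⟨
    eval (linearCombination (map generator points)) x           ∎
    where open ≡-Reasoning

MinimalAvoiding : Code m → Subset m → Subset m → Set
MinimalAvoiding D α β =
  Avoids D α β × (∀ {α′ β′} → α′ ⊆ α → β′ ⊆ β → Avoids D α′ β′ → α ⊆ α′ × β ⊆ β′)

InJ⇒Avoids : ∀ {D : Code m} {f α β} → f ≈ₚ pm α β → InJ D f → Avoids D α β
InJ⇒Avoids {f = f} {α} {β} f≈pm f∈J c c∈D box
  with () ← trans (sym (InJ⇒vanishes {f = f} f∈J c c∈D))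
                  (trans (≈ₚ⇒eval≡ {p = f} {pm α β} f≈pm c) (Box⇒eval-pm box))

MinimalAvoiding-≡ : ∀ {D : Code m} {α β α′ β′} → MinimalAvoiding D α β →
                    α′ ⊆ α → β′ ⊆ β → Avoids D α′ β′ → α ≡ α′ × β ≡ β′
MinimalAvoiding-≡ (_ , minimal) α′⊆α β′⊆β avoid′ =
  ⊆-antisym (proj₁ ⊆′) α′⊆α , ⊆-antisym (proj₂ ⊆′) β′⊆β
  where ⊆′ = minimal α′⊆α β′⊆β avoid′

module _ {D : Code m} {f : Poly m} {α β : Subset m} (f≈pm : f ≈ₚ pm α β) (α#β : Disjoint α β) where

  InCF⇒MinimalAvoiding : InCF D f → MinimalAvoiding D α β
  InCF⇒MinimalAvoiding (_ , f∈J , minimal) = InJ⇒Avoids {f = f} f≈pm f∈J , smaller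
    where
    smaller : ∀ {α′ β′} → α′ ⊆ α → β′ ⊆ β → Avoids D α′ β′ → α ⊆ α′ × β ⊆ β′
    smaller {α′} {β′} α′⊆α β′⊆β avoid′ = Box-⊆⁻ α′#β′ (pm≈pm⇒Box⊆ λ e → trans (pm′≈f e) (f≈pm e))
      where
      α′#β′ : Disjoint α′ β′
      α′#β′ = #-mono α′⊆α β′⊆β α#β
      pm′∣f : pm α′ β′ ∣ₚ f
      pm′∣f with h , pm≈h*pm′ ← pm-∣ₚ α′⊆α β′⊆β α#β = h , λ e → trans (f≈pm e) (pm≈h*pm′ e)
      pm′≈f : pm α′ β′ ≈ₚ f
      pm′≈f = minimal (pm α′ β′) (α′ , β′ , Disjoint⇒∩≡⊥ α′#β′ , λ _ → refl) (pm-InJ α′#β′ avoid′) pm′∣f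

  MinimalAvoiding⇒InCF : MinimalAvoiding D α β → InCF D f
  MinimalAvoiding⇒InCF minimal = (α , β , Disjoint⇒∩≡⊥ α#β , f≈pm) , f∈J , least
    where
    f∈J : InJ D f
    f∈J with ps , gens , pm≈ ← pm-InJ α#β (proj₁ minimal) = ps , gens , λ e → trans (f≈pm e) (pm≈ e)
    least : ∀ g → IsPseudoMonomial g → InJ D g → g ∣ₚ f → g ≈ₚ f
    least g (α′ , β′ , _ , g≈pm′) g∈J g∣f e = begin
      coeff g e           ≡⟨ g≈pm′ e ⟩
      coeff (pm α′ β′) e  ≡⟨ cong₂ (λ α″ β″ → coeff (pm α″ β″) e) (sym (proj₁ ≡′)) (sym (proj₂ ≡′)) ⟩
      coeff (pm α β) e    ≡⟨ f≈pm e ⟨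
      coeff f e           ∎
      where
      open ≡-Reasoning
      ⊆′ : α′ ⊆ α × β′ ⊆ β
      ⊆′ = Box-⊆⁻ α#β (∣ₚ⇒Box⊆ {f = f} {g} {α} {β} {α′} {β′} f≈pm g≈pm′ g∣f)
      ≡′ = MinimalAvoiding-≡ minimal (proj₁ ⊆′) (proj₂ ⊆′) (InJ⇒Avoids {f = g} g≈pm′ g∈J)

BoxExcept : Fin m → Subset m → Subset m → Subset m → Set
BoxExcept k α β c = (∀ {j} → j ∈ α → j ≢ k → j ∈ c) × (∀ {j} → j ∈ β → j ≢ k → j ∉ c)

-- Avoidance is inherited by smaller pairs, so minimality only has to be checked one literal at a time.
literals-needed⇒MinimalAvoiding : ∀ {D : Code m} {α β} → Disjoint α β → Avoids D α β →
  (∀ {k} → k ∈ α ⊎ k ∈ β → ∃[ c ] (c ∈ᶜ D × BoxExcept k α β c)) → MinimalAvoiding D α β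
literals-needed⇒MinimalAvoiding {D = D} {α} {β} α#β avoid needed = avoid , minimal
  where
  minimal : ∀ {α′ β′} → α′ ⊆ α → β′ ⊆ β → Avoids D α′ β′ → α ⊆ α′ × β ⊆ β′
  minimal {α′} {β′} α′⊆α β′⊆β avoid′ = α⊆α′ , β⊆β′
    where
    drop : ∀ {k} → k ∉ α′ → k ∉ β′ → k ∈ α ⊎ k ∈ β → Empty
    drop {k} k∉α′ k∉β′ k∈ with c , c∈D , (α∖k⊆c , β∖k#c) ← needed k∈ =
      avoid′ c c∈D ((λ j∈α′ → α∖k⊆c (α′⊆α j∈α′) λ { refl → k∉α′ j∈α′ })
                   , λ j∈β′ → β∖k#c (β′⊆β j∈β′) λ { refl → k∉β′ j∈β′ })
    α⊆α′ : α ⊆ α′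
    α⊆α′ {k} k∈α with k ∈? α′
    ... | yes k∈α′ = k∈α′
    ... | no  k∉α′ = ⊥-elim (drop k∉α′ (λ k∈β′ → α#β k∈α (β′⊆β k∈β′)) (inj₁ k∈α))
    β⊆β′ : β ⊆ β′
    β⊆β′ {k} k∈β with k ∈? β′
    ... | yes k∈β′ = k∈β′
    ... | no  k∉β′ = ⊥-elim (drop (λ k∈α′ → α#β (α′⊆α k∈α′) k∈β) k∉β′ (inj₂ k∈β))

-- The last neuron

last : Fin (suc m)
last {m} = fromℕ m

∈-∷ʳ⁻ : ∀ {p : Subset m} {b k} → k ∈ p ∷ʳ b → (∃[ i ] (k ≡ inject₁ i × i ∈ p)) ⊎ (k ≡ last × b ≡ inside)
∈-∷ʳ⁻ {p = []}    here        = inj₂ (refl , refl)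
∈-∷ʳ⁻ {p = _ ∷ p} here        = inj₁ (fzero , refl , here)
∈-∷ʳ⁻ {p = _ ∷ p} (there k∈p) with ∈-∷ʳ⁻ k∈p
... | inj₁ (i , refl , i∈p) = inj₁ (fsuc i , refl , there i∈p)
... | inj₂ (refl , b≡inside) = inj₂ (refl , b≡inside)

inject₁-∈-∷ʳ⁺ : ∀ {p : Subset m} {b i} → i ∈ p → inject₁ i ∈ p ∷ʳ b
inject₁-∈-∷ʳ⁺ here        = here
inject₁-∈-∷ʳ⁺ (there i∈p) = there (inject₁-∈-∷ʳ⁺ i∈p)

inject₁-∈-∷ʳ⁻ : ∀ {p : Subset m} {b i} → inject₁ i ∈ p ∷ʳ b → i ∈ p
inject₁-∈-∷ʳ⁻ {p = _ ∷ p} {i = fzero}  here        = here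
inject₁-∈-∷ʳ⁻ {p = _ ∷ p} {i = fsuc i} (there i∈p) = there (inject₁-∈-∷ʳ⁻ i∈p)

last-∈-∷ʳ⁺ : ∀ {p : Subset m} → last ∈ p ∷ʳ inside
last-∈-∷ʳ⁺ {p = []}    = here
last-∈-∷ʳ⁺ {p = _ ∷ p} = there last-∈-∷ʳ⁺

last-∈-∷ʳ⁻ : ∀ {p : Subset m} {b} → last ∈ p ∷ʳ b → b ≡ inside
last-∈-∷ʳ⁻ {p = []}    here          = refl
last-∈-∷ʳ⁻ {p = _ ∷ p} (there last∈) = last-∈-∷ʳ⁻ last∈

∉-⊥∷ʳoutside : ∀ {k} → k ∉ ⊥ {m} ∷ʳ outside
∉-⊥∷ʳoutside k∈ with ∈-∷ʳ⁻ k∈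
... | inj₁ (_ , _ , i∈⊥) = ∉⊥ i∈⊥
... | inj₂ (_ , ())

∈⁅i⁆∷ʳinside⁻ : ∀ {i : Fin m} {k} → k ∈ ⁅ i ⁆ ∷ʳ inside → k ≡ inject₁ i ⊎ k ≡ last
∈⁅i⁆∷ʳinside⁻ {i = i} k∈ with ∈-∷ʳ⁻ k∈
... | inj₁ (i′ , refl , i′∈⁅i⁆) = inj₁ (cong inject₁ (x∈⁅y⁆⇒x≡y i i′∈⁅i⁆))
... | inj₂ (refl , _)           = inj₂ refl

∈⁅i⁆∷ʳoutside⁻ : ∀ {i : Fin m} {k} → k ∈ ⁅ i ⁆ ∷ʳ outside → k ≡ inject₁ i
∈⁅i⁆∷ʳoutside⁻ {i = i} k∈ with ∈-∷ʳ⁻ k∈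
... | inj₁ (i′ , refl , i′∈⁅i⁆) = cong inject₁ (x∈⁅y⁆⇒x≡y i i′∈⁅i⁆)

∈⊥∷ʳinside⁻ : ∀ {k} → k ∈ ⊥ {m} ∷ʳ inside → k ≡ last
∈⊥∷ʳinside⁻ k∈ with ∈-∷ʳ⁻ k∈
... | inj₁ (_ , _ , k∈⊥) = ⊥-elim (∉⊥ k∈⊥)
... | inj₂ (refl , _)    = refl

∷ʳ-⊆⁺ : ∀ {p q : Subset m} {b c} → p ⊆ q → (b ≡ inside → c ≡ inside) → p ∷ʳ b ⊆ q ∷ʳ c
∷ʳ-⊆⁺ p⊆q bc k∈ with ∈-∷ʳ⁻ k∈
... | inj₁ (i , refl , i∈p) = inject₁-∈-∷ʳ⁺ (p⊆q i∈p)
... | inj₂ (refl , b≡inside) rewrite bc b≡inside = last-∈-∷ʳ⁺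

∷ʳ-⊆⁻ : ∀ {p q : Subset m} {b c} → p ∷ʳ b ⊆ q ∷ʳ c → p ⊆ q × (b ≡ inside → c ≡ inside)
∷ʳ-⊆⁻ pb⊆qc = (λ i∈p → inject₁-∈-∷ʳ⁻ (pb⊆qc (inject₁-∈-∷ʳ⁺ i∈p)))
             , λ { refl → last-∈-∷ʳ⁻ (pb⊆qc last-∈-∷ʳ⁺) }

∷ʳ-#⁺ : ∀ {p q : Subset m} {b c} → Disjoint p q → (b ≡ inside → c ≡ outside) → Disjoint (p ∷ʳ b) (q ∷ʳ c)
∷ʳ-#⁺ p#q bc k∈pb k∈qc with ∈-∷ʳ⁻ k∈pb
... | inj₁ (i , refl , i∈p)  = p#q i∈p (inject₁-∈-∷ʳ⁻ k∈qc)
... | inj₂ (refl , b≡inside) with () ← trans (sym (bc b≡inside)) (last-∈-∷ʳ⁻ k∈qc)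

∷ʳ-#⁻ : ∀ {p q : Subset m} {b c} → Disjoint (p ∷ʳ b) (q ∷ʳ c) → Disjoint p q × (b ≡ inside → c ≡ outside)
∷ʳ-#⁻ pb#qc = (λ i∈p i∈q → pb#qc (inject₁-∈-∷ʳ⁺ i∈p) (inject₁-∈-∷ʳ⁺ i∈q)) , head pb#qc
  where
  head : ∀ {p q : Subset _} {b c} → Disjoint (p ∷ʳ b) (q ∷ʳ c) → b ≡ inside → c ≡ outside
  head {c = inside}  pb#qc refl = ⊥-elim (pb#qc last-∈-∷ʳ⁺ last-∈-∷ʳ⁺)
  head {c = outside} pb#qc refl = refl

Box-∷ʳ⁺ : ∀ {a b c} {α β x : Subset m} → Literal a b c → Box α β x → Box (α ∷ʳ a) (β ∷ʳ b) (x ∷ʳ c)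
Box-∷ʳ⁺ (ac , bc) (α⊆x , β#x) = ∷ʳ-⊆⁺ α⊆x ac , ∷ʳ-#⁺ β#x bc

Box-∷ʳ⁻ : ∀ {a b c} {α β x : Subset m} → Box (α ∷ʳ a) (β ∷ʳ b) (x ∷ʳ c) → Literal a b c × Box α β x
Box-∷ʳ⁻ (⊆ , #) = (proj₂ (∷ʳ-⊆⁻ ⊆) , proj₂ (∷ʳ-#⁻ #)) , proj₁ (∷ʳ-⊆⁻ ⊆) , proj₁ (∷ʳ-#⁻ #)

∀-∷ʳ : ∀ {P : Subset (suc m) → Set} → (∀ x d → P (x ∷ʳ d)) → ∀ y → P y
∀-∷ʳ h y with x , d , refl ← initLast y = h x d

multilinear-∷ʳ0 : ∀ {e : Mono m} → Multilinear e → Multilinear (e ∷ʳ 0)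
multilinear-∷ʳ0 {e = []}    ml fzero    = z≤n
multilinear-∷ʳ0 {e = _ ∷ e} ml fzero    = ml fzero
multilinear-∷ʳ0 {e = _ ∷ e} ml (fsuc k) = multilinear-∷ʳ0 {e = e} (multilinear-tail ml) k

embedP-cong : ∀ {p q : Poly m} → p ≈ₚ q → embedP p ≈ₚ embedP q
embedP-cong {p = p} {q} p≈q e = begin
  coeff (embedP p) e                       ≡⟨ coeff-parity (embedP p) e ⟩
  parity (_≡ᵐ e) (embedP p)                ≡⟨ parity-map (_≡ᵐ e) (_∷ʳ 0) p ⟩
  parity (λ e′ → (e′ ∷ʳ 0) ≡ᵐ e) p         ≡⟨ ≈ₚ⇒parity≡ {p = p} {q} p≈q (λ e′ → (e′ ∷ʳ 0) ≡ᵐ e) ⟩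
  parity (λ e′ → (e′ ∷ʳ 0) ≡ᵐ e) q         ≡⟨ parity-map (_≡ᵐ e) (_∷ʳ 0) q ⟨
  parity (_≡ᵐ e) (embedP q)                ≡⟨ coeff-parity (embedP q) e ⟨
  coeff (embedP q) e                       ∎
  where open ≡-Reasoning

pm≈embedP : ∀ {α β : Subset m} → Disjoint α β → pm (α ∷ʳ outside) (β ∷ʳ outside) ≈ₚ embedP (pm α β)
pm≈embedP {α = α} {β} α#β = pm-≈ₚ (∷ʳ-#⁺ α#β (λ ())) multilinear
  (∀-∷ʳ λ x d box → trans (eval-embedP (pm α β) x d) (Box⇒eval-pm (proj₂ (Box-∷ʳ⁻ box))))
  (∀-∷ʳ λ x d eq → Box-∷ʳ⁺ ((λ ()) , (λ ())) (eval-pm⇒Box (trans (sym (eval-embedP (pm α β) x d)) eq)))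
  where
  multilinear : All Multilinear (embedP (pm α β))
  multilinear = Allₚ.map⁺ (All.map (λ {e} → multilinear-∷ʳ0 {e = e}) (pm-multilinear α#β))

⁅last⁆#⁅inject₁⁆ : ∀ (i : Fin m) → Disjoint ⁅ last ⁆ ⁅ inject₁ i ⁆
⁅last⁆#⁅inject₁⁆ i k∈last k∈i =
  Fin.fromℕ≢inject₁ {i = i} (trans (sym (x∈⁅y⁆⇒x≡y last k∈last)) (x∈⁅y⁆⇒x≡y (inject₁ i) k∈i))

xₙxᵢ-disjoint : ∀ (i : Fin m) → Disjoint (⁅ i ⁆ ∷ʳ inside) (⊥ ∷ʳ outside)
xₙxᵢ-disjoint i = ∷ʳ-#⁺ (λ _ → ∉⊥) (λ _ → refl)

xₙ[1-xⱼ]-disjoint : ∀ (j : Fin m) → Disjoint (⊥ ∷ʳ inside) (⁅ j ⁆ ∷ʳ outside)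
xₙ[1-xⱼ]-disjoint j = ∷ʳ-#⁺ (λ k∈⊥ _ → ∉⊥ k∈⊥) (λ _ → refl)

pm≈xₙxᵢ : ∀ (i : Fin m) → pm (⁅ i ⁆ ∷ʳ inside) (⊥ ∷ʳ outside) ≈ₚ var last *ₚ var (inject₁ i)
pm≈xₙxᵢ i = pm-≈ₚ (xₙxᵢ-disjoint i) multilinear
  (λ y (⊆y , _) → trans (eval-*ₚ (var last) (var (inject₁ i)) y)
                        (∧-true⁺ (eval-var⁺ (⊆y last-∈-∷ʳ⁺)) (eval-var⁺ (⊆y (inject₁-∈-∷ʳ⁺ (x∈⁅x⁆ i))))))
  box
  where
  multilinear : All Multilinear (var last *ₚ var (inject₁ i))
  multilinear = supported⇒multilinear
    (supported-*ₚ (⁅last⁆#⁅inject₁⁆ i) (supported-var last) (supported-var (inject₁ i)))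
  box : ∀ y → eval (var last *ₚ var (inject₁ i)) y ≡ true → Box (⁅ i ⁆ ∷ʳ inside) (⊥ ∷ʳ outside) y
  box y eq = α⊆y , λ k∈⊥ _ → ∉-⊥∷ʳoutside k∈⊥
    where
    both = ∧-true⁻ (trans (sym (eval-*ₚ (var last) (var (inject₁ i)) y)) eq)
    α⊆y : ⁅ i ⁆ ∷ʳ inside ⊆ y
    α⊆y k∈ with ∈⁅i⁆∷ʳinside⁻ k∈
    ... | inj₁ refl = eval-var⁻ (proj₂ both)
    ... | inj₂ refl = eval-var⁻ (proj₁ both)

pm≈xₙ[1-xⱼ] : ∀ (j : Fin m) → pm (⊥ ∷ʳ inside) (⁅ j ⁆ ∷ʳ outside) ≈ₚ var last *ₚ (oneₚ +ₚ var (inject₁ j))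
pm≈xₙ[1-xⱼ] j = pm-≈ₚ (xₙ[1-xⱼ]-disjoint j) multilinear
  (λ y (⊆y , #y) → trans (eval-*ₚ (var last) (oneₚ +ₚ var (inject₁ j)) y)
                         (∧-true⁺ (eval-var⁺ (⊆y last-∈-∷ʳ⁺)) (eval-1+var⁺ (#y (inject₁-∈-∷ʳ⁺ (x∈⁅x⁆ j))))))
  box
  where
  multilinear : All Multilinear (var last *ₚ (oneₚ +ₚ var (inject₁ j)))
  multilinear = supported⇒multilinear (supported-*ₚ (⁅last⁆#⁅inject₁⁆ j) (supported-var last)
    (Allₚ.++⁺ (supported-mono ⊥⊆ supported-oneₚ) (supported-var (inject₁ j))))
  box : ∀ y → eval (var last *ₚ (oneₚ +ₚ var (inject₁ j))) y ≡ true → Box (⊥ ∷ʳ inside) (⁅ j ⁆ ∷ʳ outside) y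
  box y eq = α⊆y , β#y
    where
    both = ∧-true⁻ (trans (sym (eval-*ₚ (var last) (oneₚ +ₚ var (inject₁ j)) y)) eq)
    α⊆y : ⊥ ∷ʳ inside ⊆ y
    α⊆y k∈ with refl ← ∈⊥∷ʳinside⁻ k∈ = eval-var⁻ (proj₁ both)
    β#y : Disjoint (⁅ j ⁆ ∷ʳ outside) y
    β#y k∈ with refl ← ∈⁅i⁆∷ʳoutside⁻ k∈ = eval-1+var⁻ (proj₂ both)

-- Piercings

module Piercing {m k : ℕ} (C : Code (suc m)) (σ τ : Subset m)
                (isCode : IsCode C) (piercing : IsPiercing k C σ τ) where

  D : Code m
  D = delete C

  private
    [σ,τ]⊆D : ∀ c → c ∈[ σ , τ ] → c ∈ᶜ D
    [σ,τ]⊆D = proj₁ (proj₂ (proj₂ piercing))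
    C-shape : ∀ c → c ∈ᶜ C ⇔ ((∃[ c′ ] (c ≡ c′ ∷ʳ outside × c′ ∈ᶜ D)) ⊎ c ∈[ σ ∷ʳ inside , τ ∷ʳ inside ])
    C-shape = proj₂ (proj₂ (proj₂ piercing))

  σ∈[σ,τ] : σ ∈[ σ , τ ]
  σ∈[σ,τ] = ⊆-refl , proj₁ piercing

  ∷ʳoutside∈C⇒ : ∀ {c} → (c ∷ʳ outside) ∈ᶜ C → c ∈ᶜ D
  ∷ʳoutside∈C⇒ {c} c0∈C = cong (_∨ C (c ∷ʳ inside)) c0∈C

  ∷ʳoutside∈C⇐ : ∀ {c} → c ∈ᶜ D → (c ∷ʳ outside) ∈ᶜ C
  ∷ʳoutside∈C⇐ {c} c∈D = Equivalence.from (C-shape (c ∷ʳ outside)) (inj₁ (c , refl , c∈D))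

  ∷ʳinside∈C⇒ : ∀ {c} → (c ∷ʳ inside) ∈ᶜ C → c ∈[ σ , τ ]
  ∷ʳinside∈C⇒ {c} c1∈C with Equivalence.to (C-shape (c ∷ʳ inside)) c1∈C
  ... | inj₁ (c′ , c1≡c′0 , _) with () ← Vec.∷ʳ-injectiveʳ c c′ c1≡c′0
  ... | inj₂ (σ1⊆c1 , c1⊆τ1)   = proj₁ (∷ʳ-⊆⁻ σ1⊆c1) , proj₁ (∷ʳ-⊆⁻ c1⊆τ1)

  ∷ʳinside∈C⇐ : ∀ {c} → c ∈[ σ , τ ] → (c ∷ʳ inside) ∈ᶜ C
  ∷ʳinside∈C⇐ {c} (σ⊆c , c⊆τ) =
    Equivalence.from (C-shape (c ∷ʳ inside)) (inj₂ (∷ʳ-⊆⁺ σ⊆c id , ∷ʳ-⊆⁺ c⊆τ id))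

  ∈C⇒∈D : ∀ {c} d → (c ∷ʳ d) ∈ᶜ C → c ∈ᶜ D
  ∈C⇒∈D outside = ∷ʳoutside∈C⇒
  ∈C⇒∈D inside  = [σ,τ]⊆D _ ∘ ∷ʳinside∈C⇒

  Avoids-lift : ∀ {α β : Subset m} → Avoids D α β → Avoids C (α ∷ʳ outside) (β ∷ʳ outside)
  Avoids-lift avoid = ∀-∷ʳ λ c d c∈C box → avoid c (∈C⇒∈D d c∈C) (proj₂ (Box-∷ʳ⁻ box))

  Avoids-restrict : ∀ {α β : Subset m} {a b} → Literal a b outside → Avoids C (α ∷ʳ a) (β ∷ʳ b) → Avoids D α β
  Avoids-restrict lit avoid c c∈D box = avoid (c ∷ʳ outside) (∷ʳoutside∈C⇐ c∈D) (Box-∷ʳ⁺ lit box)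

  MinimalAvoiding-lift⁻ : ∀ {α β : Subset m} →
                          MinimalAvoiding C (α ∷ʳ outside) (β ∷ʳ outside) → MinimalAvoiding D α β
  MinimalAvoiding-lift⁻ (avoid , minimal) = Avoids-restrict ((λ ()) , (λ ())) avoid , λ α′⊆α β′⊆β avoid′ →
    let ⊆′ = minimal (∷ʳ-⊆⁺ α′⊆α id) (∷ʳ-⊆⁺ β′⊆β id) (Avoids-lift avoid′)
    in proj₁ (∷ʳ-⊆⁻ (proj₁ ⊆′)) , proj₁ (∷ʳ-⊆⁻ (proj₂ ⊆′))

  MinimalAvoiding-lift⁺ : ∀ {α β : Subset m} →
                          MinimalAvoiding D α β → MinimalAvoiding C (α ∷ʳ outside) (β ∷ʳ outside)
  MinimalAvoiding-lift⁺ {α} {β} (avoid , minimal) = Avoids-lift avoid , minimal′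
    where
    minimal′ : ∀ {A′ B′} → A′ ⊆ α ∷ʳ outside → B′ ⊆ β ∷ʳ outside → Avoids C A′ B′ →
               α ∷ʳ outside ⊆ A′ × β ∷ʳ outside ⊆ B′
    minimal′ {A′} {B′} A′⊆ B′⊆ avoid′
      with α′ , a′ , refl ← initLast A′ | β′ , b′ , refl ← initLast B′ =
      ∷ʳ-⊆⁺ (proj₁ ⊆′) (λ ()) , ∷ʳ-⊆⁺ (proj₂ ⊆′) (λ ())
      where
      ⊆′ = minimal (proj₁ (∷ʳ-⊆⁻ A′⊆)) (proj₁ (∷ʳ-⊆⁻ B′⊆))
                   (Avoids-restrict (proj₂ (∷ʳ-⊆⁻ A′⊆) , λ _ → refl) avoid′)

  -- Dropping the literal 1 - x_n keeps the box away from C.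
  ¬MinimalAvoiding-[1-xₙ] : ∀ {α β : Subset m} → ¬ MinimalAvoiding C (α ∷ʳ outside) (β ∷ʳ inside)
  ¬MinimalAvoiding-[1-xₙ] (avoid , minimal)
    with () ← proj₂ (∷ʳ-⊆⁻ (proj₂ (minimal ⊆-refl (∷ʳ-⊆⁺ ⊆-refl λ ())
                               (Avoids-lift (Avoids-restrict ((λ ()) , λ _ → refl) avoid))))) refl

  Avoids-xₙ⁺ : ∀ {α β : Subset m} → (∀ c → c ∈[ σ , τ ] → ¬ Box α β c) → Avoids C (α ∷ʳ inside) (β ∷ʳ outside)
  Avoids-xₙ⁺ {α} {β} avoid = ∀-∷ʳ λ c d c∈C box → case d c∈C (Box-∷ʳ⁻ box)
    where
    case : ∀ {c} d → (c ∷ʳ d) ∈ᶜ C → Literal inside outside d × Box α β c → Empty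
    case outside _    ((d≡inside , _) , _) with () ← d≡inside refl
    case inside  c∈C  (_ , box)            = avoid _ (∷ʳinside∈C⇒ c∈C) box

  Avoids-xₙ⁻ : ∀ {α β : Subset m} → Avoids C (α ∷ʳ inside) (β ∷ʳ outside) → ∀ c → c ∈[ σ , τ ] → ¬ Box α β c
  Avoids-xₙ⁻ avoid c c∈[σ,τ] box =
    avoid (c ∷ʳ inside) (∷ʳinside∈C⇐ c∈[σ,τ]) (Box-∷ʳ⁺ ((λ _ → refl) , λ ()) box)

  xₙxᵢ-minimal : ∀ {i} → i ∉ τ → MinimalAvoiding C (⁅ i ⁆ ∷ʳ inside) (⊥ ∷ʳ outside)
  xₙxᵢ-minimal {i} i∉τ = literals-needed⇒MinimalAvoiding (xₙxᵢ-disjoint i)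
    (Avoids-xₙ⁺ λ c (_ , c⊆τ) (⁅i⁆⊆c , _) → i∉τ (c⊆τ (⁅i⁆⊆c (x∈⁅x⁆ i)))) needed
    where
    needed : ∀ {k} → k ∈ ⁅ i ⁆ ∷ʳ inside ⊎ k ∈ ⊥ ∷ʳ outside →
             ∃[ c ] (c ∈ᶜ C × BoxExcept k (⁅ i ⁆ ∷ʳ inside) (⊥ ∷ʳ outside) c)
    needed (inj₂ k∈⊥) = ⊥-elim (∉-⊥∷ʳoutside k∈⊥)
    needed (inj₁ k∈) with ∈⁅i⁆∷ʳinside⁻ k∈
    ... | inj₁ refl = σ ∷ʳ inside , ∷ʳinside∈C⇐ σ∈[σ,τ] , α-part , λ j∈⊥ _ → ⊥-elim (∉-⊥∷ʳoutside j∈⊥)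
      where
      α-part : ∀ {j} → j ∈ ⁅ i ⁆ ∷ʳ inside → j ≢ inject₁ i → j ∈ σ ∷ʳ inside
      α-part j∈ j≢i with ∈⁅i⁆∷ʳinside⁻ j∈
      ... | inj₁ j≡i    = ⊥-elim (j≢i j≡i)
      ... | inj₂ refl   = last-∈-∷ʳ⁺
    ... | inj₂ refl with y , y∈C , i∈y ← proj₁ (proj₂ isCode) (inject₁ i) =
      y , y∈C , α-part , λ j∈⊥ _ → ⊥-elim (∉-⊥∷ʳoutside j∈⊥)
      where
      α-part : ∀ {j} → j ∈ ⁅ i ⁆ ∷ʳ inside → j ≢ last → j ∈ y
      α-part j∈ j≢last with ∈⁅i⁆∷ʳinside⁻ j∈
      ... | inj₁ refl     = i∈y
      ... | inj₂ j≡last   = ⊥-elim (j≢last j≡last)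

  xₙ[1-xⱼ]-minimal : ∀ {j} → j ∈ σ → MinimalAvoiding C (⊥ ∷ʳ inside) (⁅ j ⁆ ∷ʳ outside)
  xₙ[1-xⱼ]-minimal {j} j∈σ = literals-needed⇒MinimalAvoiding (xₙ[1-xⱼ]-disjoint j)
    (Avoids-xₙ⁺ λ c (σ⊆c , _) (_ , ⁅j⁆#c) → ⁅j⁆#c (x∈⁅x⁆ j) (σ⊆c j∈σ)) needed
    where
    needed : ∀ {k} → k ∈ ⊥ ∷ʳ inside ⊎ k ∈ ⁅ j ⁆ ∷ʳ outside →
             ∃[ c ] (c ∈ᶜ C × BoxExcept k (⊥ ∷ʳ inside) (⁅ j ⁆ ∷ʳ outside) c)
    needed (inj₁ k∈) with refl ← ∈⊥∷ʳinside⁻ k∈ =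
      ⊥ , proj₁ isCode , (λ j′∈ j′≢last → ⊥-elim (j′≢last (∈⊥∷ʳinside⁻ j′∈))) , λ _ _ → ∉⊥
    needed (inj₂ k∈) with refl ← ∈⁅i⁆∷ʳoutside⁻ k∈ =
      σ ∷ʳ inside , ∷ʳinside∈C⇐ σ∈[σ,τ] ,
      (λ j′∈ _ → subst (_∈ σ ∷ʳ inside) (sym (∈⊥∷ʳinside⁻ j′∈)) last-∈-∷ʳ⁺) ,
      λ j′∈ j′≢j → ⊥-elim (j′≢j (∈⁅i⁆∷ʳoutside⁻ j′∈))

  MinimalAvoiding-xₙ-cases : ∀ {α β} → Disjoint α β → MinimalAvoiding C (α ∷ʳ inside) (β ∷ʳ outside) →
             (∃[ i ] (i ∉ τ × α ≡ ⁅ i ⁆ × β ≡ ⊥)) ⊎ (∃[ j ] (j ∈ σ × α ≡ ⊥ × β ≡ ⁅ j ⁆))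
  MinimalAvoiding-xₙ-cases {α} {β} α#β minimal with nonempty? (α ─ τ) | nonempty? (β ∩ σ)
  ... | yes (i , i∈α─τ) | _ =
    inj₁ (i , i∉τ , Vec.∷ʳ-injectiveˡ _ _ (proj₁ ≡′) , Vec.∷ʳ-injectiveˡ _ _ (proj₂ ≡′))
    where
    i∉τ = ∈─⇒∉ α τ i∈α─τ
    ≡′ = MinimalAvoiding-≡ minimal (∷ʳ-⊆⁺ (⁅⁆-⊆ (p─q⊆p α τ i∈α─τ)) id) (∷ʳ-⊆⁺ ⊥⊆ id)
                           (proj₁ (xₙxᵢ-minimal i∉τ))
  ... | no _ | yes (j , j∈β∩σ) =
    inj₂ (j , j∈σ , Vec.∷ʳ-injectiveˡ _ _ (proj₁ ≡′) , Vec.∷ʳ-injectiveˡ _ _ (proj₂ ≡′))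
    where
    j∈σ = proj₂ (x∈p∩q⁻ β σ j∈β∩σ)
    ≡′ = MinimalAvoiding-≡ minimal (∷ʳ-⊆⁺ ⊥⊆ id) (∷ʳ-⊆⁺ (⁅⁆-⊆ (proj₁ (x∈p∩q⁻ β σ j∈β∩σ))) id)
                           (proj₁ (xₙ[1-xⱼ]-minimal j∈σ))
  -- Otherwise the point σ ∪ α of [σ, τ] lies in the box.
  ... | no α⊈τ | no β∩σ≡∅ =
    ⊥-elim (Avoids-xₙ⁻ (proj₁ minimal) (σ ∪ α) (p⊆p∪q α , ∪-⊆ (proj₂ σ∈[σ,τ]) α⊆τ) (q⊆p∪q σ α , β#σ∪α))
    where
    α⊆τ : α ⊆ τ
    α⊆τ {k} k∈α with k ∈? τ
    ... | yes k∈τ = k∈τ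
    ... | no  k∉τ = ⊥-elim (α⊈τ (k , x∈p∧x∉q⇒x∈p─q k∈α k∉τ))
    β#σ∪α : Disjoint β (σ ∪ α)
    β#σ∪α {k} k∈β k∈σ∪α =
      [ (λ k∈σ → β∩σ≡∅ (k , x∈p∩q⁺ (k∈β , k∈σ))) , (λ k∈α → α#β k∈α k∈β) ]′ (x∈p∪q⁻ σ α k∈σ∪α)

  Parts : Poly (suc m) → Set
  Parts f = Part₁ C f ⊎ Part₂ τ f ⊎ Part₃ σ f

  MinimalAvoiding⇒Parts : ∀ {f} α a β b → f ≈ₚ pm (α ∷ʳ a) (β ∷ʳ b) → Disjoint (α ∷ʳ a) (β ∷ʳ b) →
                          MinimalAvoiding C (α ∷ʳ a) (β ∷ʳ b) → Parts f
  MinimalAvoiding⇒Parts α outside β outside f≈pm α#β minimal =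
    inj₁ (pm α β , MinimalAvoiding⇒InCF {f = pm α β} (λ _ → refl) α#β′ (MinimalAvoiding-lift⁻ minimal) ,
          λ e → trans (f≈pm e) (pm≈embedP α#β′ e))
    where α#β′ = proj₁ (∷ʳ-#⁻ α#β)
  MinimalAvoiding⇒Parts α outside β inside  _ _ minimal = ⊥-elim (¬MinimalAvoiding-[1-xₙ] minimal)
  MinimalAvoiding⇒Parts α inside  β inside  _ α#β _ with () ← proj₂ (∷ʳ-#⁻ α#β) refl
  MinimalAvoiding⇒Parts α inside  β outside f≈pm α#β minimal
    with MinimalAvoiding-xₙ-cases (proj₁ (∷ʳ-#⁻ α#β)) minimal
  ... | inj₁ (i , i∉τ , refl , refl) = inj₂ (inj₁ (i , i∉τ , λ e → trans (f≈pm e) (pm≈xₙxᵢ i e)))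
  ... | inj₂ (j , j∈σ , refl , refl) = inj₂ (inj₂ (j , j∈σ , λ e → trans (f≈pm e) (pm≈xₙ[1-xⱼ] j e)))

  InCF⇒Parts : ∀ f → InCF C f → Parts f
  InCF⇒Parts f f∈CF
    with αₙ , βₙ , αₙ∩βₙ≡⊥ , f≈pm ← proj₁ f∈CF
    with α , a , refl ← initLast αₙ | β , b , refl ← initLast βₙ =
    MinimalAvoiding⇒Parts {f = f} α a β b f≈pm αₙ#βₙ (InCF⇒MinimalAvoiding {f = f} f≈pm αₙ#βₙ f∈CF)
    where αₙ#βₙ = ∩≡⊥⇒Disjoint αₙ∩βₙ≡⊥

  Part₁⇒MinimalAvoiding : ∀ {f} → Part₁ C f →
    ∃[ α ] ∃[ β ] (Disjoint α β × f ≈ₚ pm (α ∷ʳ outside) (β ∷ʳ outside) × MinimalAvoiding D α β)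
  Part₁⇒MinimalAvoiding {f} (g , g∈CF , f≈g) with α , β , α∩β≡⊥ , g≈pm ← proj₁ g∈CF =
    α , β , α#β , f≈pm , InCF⇒MinimalAvoiding {f = g} g≈pm α#β g∈CF
    where
    α#β = ∩≡⊥⇒Disjoint α∩β≡⊥
    f≈pm : f ≈ₚ pm (α ∷ʳ outside) (β ∷ʳ outside)
    f≈pm e = trans (f≈g e) (trans (embedP-cong {p = g} {pm α β} g≈pm e) (sym (pm≈embedP α#β e)))

  Parts⇒InCF : ∀ f → Parts f → InCF C f
  Parts⇒InCF f (inj₁ p₁) with α , β , α#β , f≈pm , minimal ← Part₁⇒MinimalAvoiding {f = f} p₁ =
    MinimalAvoiding⇒InCF {f = f} f≈pm (∷ʳ-#⁺ α#β λ ()) (MinimalAvoiding-lift⁺ minimal)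
  Parts⇒InCF f (inj₂ (inj₁ (i , i∉τ , f≈))) =
    MinimalAvoiding⇒InCF {f = f} (λ e → trans (f≈ e) (sym (pm≈xₙxᵢ i e))) (xₙxᵢ-disjoint i) (xₙxᵢ-minimal i∉τ)
  Parts⇒InCF f (inj₂ (inj₂ (j , j∈σ , f≈))) =
    MinimalAvoiding⇒InCF {f = f} (λ e → trans (f≈ e) (sym (pm≈xₙ[1-xⱼ] j e))) (xₙ[1-xⱼ]-disjoint j)
                                 (xₙ[1-xⱼ]-minimal j∈σ)

  Part₁∩Part₂≡∅ : ∀ f → Part₁ C f → ¬ Part₂ τ f
  Part₁∩Part₂≡∅ f p₁ (i , _ , f≈) with α , β , α#β , f≈pm , _ ← Part₁⇒MinimalAvoiding {f = f} p₁
    with () ← Vec.∷ʳ-injectiveʳ α ⁅ i ⁆ (proj₁ (pm-injective (∷ʳ-#⁺ α#β λ ()) (xₙxᵢ-disjoint i)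
                                          λ e → trans (sym (f≈pm e)) (trans (f≈ e) (sym (pm≈xₙxᵢ i e)))))

  Part₁∩Part₃≡∅ : ∀ f → Part₁ C f → ¬ Part₃ σ f
  Part₁∩Part₃≡∅ f p₁ (j , _ , f≈) with α , β , α#β , f≈pm , _ ← Part₁⇒MinimalAvoiding {f = f} p₁
    with () ← Vec.∷ʳ-injectiveʳ α ⊥ (proj₁ (pm-injective (∷ʳ-#⁺ α#β λ ()) (xₙ[1-xⱼ]-disjoint j)
                                      λ e → trans (sym (f≈pm e)) (trans (f≈ e) (sym (pm≈xₙ[1-xⱼ] j e)))))

  Part₂∩Part₃≡∅ : ∀ f → Part₂ τ f → ¬ Part₃ σ f
  Part₂∩Part₃≡∅ f (i , _ , f≈) (j , _ , f≈′) = ∉⊥ (subst (j ∈_) (sym ⊥≡⁅j⁆) (x∈⁅x⁆ j))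
    where
    ⊥≡⁅j⁆ : ⊥ ≡ ⁅ j ⁆
    ⊥≡⁅j⁆ = Vec.∷ʳ-injectiveˡ ⊥ ⁅ j ⁆ (proj₂ (pm-injective (xₙxᵢ-disjoint i) (xₙ[1-xⱼ]-disjoint j)
      λ e → trans (pm≈xₙxᵢ i e) (trans (sym (f≈ e)) (trans (f≈′ e) (sym (pm≈xₙ[1-xⱼ] j e))))))

lemma2 : (m k : ℕ) (C : Code (suc m)) (σ τ : Subset m)
    → IsCode C → IsPiercing k C σ τ
    → (∀ f → InCF C f ⇔ (Part₁ C f ⊎ Part₂ τ f ⊎ Part₃ σ f))
      × (∀ f → Part₁ C f → ¬ Part₂ τ f)
      × (∀ f → Part₁ C f → ¬ Part₃ σ f)
      × (∀ f → Part₂ τ f → ¬ Part₃ σ f)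
lemma2 m k C σ τ isCode piercing =
  (λ f → mk⇔ (InCF⇒Parts f) (Parts⇒InCF f)) , Part₁∩Part₂≡∅ , Part₁∩Part₃≡∅ , Part₂∩Part₃≡∅
  where open Piercing C σ τ isCode piercing
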